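{- Let $m \ge 1$ and let $d_1,\dots,d_m$ be positive integers with $\gcd(d_1,\dots,d_m)=1$. Let $S=\langle d_1,\dots,d_m\rangle$ be the numerical semigroup they generate, with gap set $\Delta=\mathbb{Z}_{\ge 0}\setminus S$ (finite), and let $Q_S(z)$, $\mathcal{C}_n(S)$, $K_p(S)$, $G_r(S)$, $\pi_m$, $\sigma_k$, $\delta_k$ and $T_n$ be as in the context. Then for every integer $p \ge 0$, \[ K_p(S) = \sum_{r=0}^p \binom{p}{r} T_{p-r}(\sigma)\, G_r(S) + \frac{2^{p+1}}{p+1}\, T_{p+1}(\delta). \]
   Context: The semigroup $S=\langle d_1,\dots,d_m\rangle$ is the set of all non-negative integer combinations of $d_1,\dots,d_m$ (so $0\in S$). Its Hilbert series is $H_S(z)=\sum_{s\in S} z^s$, and the Hilbert numerator is the polynomial $Q_S(z)\in\mathbb{Z}[z]$ defined by $H_S(z)=Q_S(z)/\prod_{i=1}^m(1-z^{d_i})$. Writing $1-Q_S(z)=\sum_{k\ge 0} c_k z^k$, define for $n\ge 0$ the alternating syzygy power sums $\mathcal{C}_n(S)=\sum_{k\ge 0} k^n c_k$ (with the convention $0^0=1$). Let $\pi_m=d_1 d_2\cdots d_m$, and for $p\ge 0$ define \[K_p(S)=\frac{\mathcal{C}_{m+p}(S)}{(-1)^m\,\pi_m\,\frac{(m+p)!}{p!}}.\] The gap power sums are $G_r(S)=\sum_{g\in\Delta} g^r$ for $r\ge 0$. Let $\sigma_k=\sum_{i=1}^m d_i^k$ and $\delta_k=(\sigma_k-1)/2^k$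 for $k\ge1$. The universal symmetric polynomials: for each $n\ge 0$, $T_n\in\mathbb{Q}[s_1,\dots,s_n]$ is the unique polynomial such that for every $M\ge1$ and all (indeterminates) $x_1,\dots,x_M$, one has $T_n\big(\sum_i x_i,\sum_i x_i^2,\dots,\sum_i x_i^n\big)= n!\,[t^n]\prod_{i=1}^M \frac{e^{x_i t}-1}{x_i t}$ (coefficient extraction in the formal power series ring in $t$). Then $T_n(\sigma)$ means $T_n(\sigma_1,\dots,\sigma_n)$ and $T_n(\delta)$ means $T_n(\delta_1,\dots,\delta_n)$. For example $T_0=1$, $T_1=s_1/2$, $T_2=(3s_1^2+s_2)/12$. -}

module Defs where

open import Data.Nat as ℕ using (ℕ; zero; suc; _<_; _≤?_; NonZero; _!)
open import Data.Nat.Properties using (m*n≢0; _!≢0)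
open import Data.Nat.GCD using (gcd)
open import Data.Nat.Combinatorics using (_C_)
open import Data.Integer as ℤ using (ℤ; +_)
open import Data.Rational as ℚ using (ℚ; 0ℚ; 1ℚ; _/_)
open import Data.List as List using (List; []; _∷_; upTo; map; _++_; [_])
open import Data.List.Membership.DecPropositional (ℕ._≟_) using (_∈?_)
open import Data.Vec as Vec using (Vec; []; _∷_; foldr; zipWith; toList)
open import Data.Vec.Relation.Unary.All as All using (All; []; _∷_)
open import Data.Product using (∃-syntax)
open import Relation.Binary.PropositionalEquality using (_≡_)
open import Relation.Nullary.Decidable using (does)
open import Data.Bool using (if_then_else_)

Σℚ< : ℕ → (ℕ → ℚ) → ℚ
Σℚ< n f = List.foldr ℚ._+_ 0ℚ (map f (upTo n))

Σℤ≤ : ℕ → (ℕ → ℤ) → ℤ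
Σℤ≤ n f = List.foldr ℤ._+_ (+ 0) (map f (upTo (suc n)))

ℕ→ℚ : ℕ → ℚ
ℕ→ℚ n = + n / 1

ℤ→ℚ : ℤ → ℚ
ℤ→ℚ z = z / 1

InS : ∀ {m} → Vec ℕ m → ℕ → Set
InS {m} ds n = ∃[ c ] (Vec.sum (zipWith ℕ._*_ c ds) ≡ n)

gcdVec : ∀ {m} → Vec ℕ m → ℕ
gcdVec = foldr (λ _ → ℕ) gcd 0

πm : ∀ {m} → Vec ℕ m → ℕ
πm = foldr (λ _ → ℕ) ℕ._*_ 1

πm-nonZero : ∀ {m} (ds : Vec ℕ m) → All (0 <_) ds → NonZero (πm ds)
πm-nonZero [] [] = _
πm-nonZero (d ∷ ds) (ℕ.z<s ∷ ps) = m*n≢0 d (πm ds) {{_}} {{πm-nonZero ds ps}}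

-- Hilbert series / Hilbert numerator, given the gap set Δ as a list.
-- Coefficient of z^n in H_S(z) is 1 if n ∈ S and 0 otherwise, i.e.
-- 1 - [n ∈ Δ].

hilbCoeff : List ℕ → ℕ → ℤ
hilbCoeff gaps n = if does (n ∈? gaps) then + 0 else + 1

-- coefficient of z^k in ∏_{d ∈ ds} (1 - z^d)
prodCoeff : ∀ {m} → Vec ℕ m → ℕ → ℤ
prodCoeff [] zero = + 1
prodCoeff [] (suc k) = + 0
prodCoeff (d ∷ ds) k =
  prodCoeff ds k ℤ.- (if does (d ≤? k) then prodCoeff ds (k ℕ.∸ d) else + 0)

-- coefficient of z^k in Q_S(z) = H_S(z) ∏ (1 - z^{d_i})
QCoeff : ∀ {m} → Vec ℕ m → List ℕ → ℕ → ℤ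
QCoeff ds gaps k = Σℤ≤ k (λ j → hilbCoeff gaps (k ℕ.∸ j) ℤ.* prodCoeff ds j)

-- c_k, where 1 - Q_S(z) = Σ c_k z^k
cCoeff : ∀ {m} → Vec ℕ m → List ℕ → ℕ → ℤ
cCoeff ds gaps zero = + 1 ℤ.- QCoeff ds gaps zero
cCoeff ds gaps (suc k) = ℤ.- QCoeff ds gaps (suc k)

-- 𝒞_n(S) = Σ_k k^n c_k, the sum truncated at N (N is any bound on the
-- support of Q_S; k^n uses 0^0 = 1 as ℕ._^_ does)
𝒞 : ∀ {m} → Vec ℕ m → List ℕ → (N n : ℕ) → ℤ
𝒞 ds gaps N n = Σℤ≤ N (λ k → + (k ℕ.^ n) ℤ.* cCoeff ds gaps k)

-- K_p(S) = 𝒞_{m+p} / ((-1)^m π_m (m+p)!/p!)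
--        = (-1)^m p! 𝒞_{m+p} / (π_m (m+p)!)
K : ∀ {m} (ds : Vec ℕ m) → All (0 <_) ds → List ℕ → (N p : ℕ) → ℚ
K {m} ds pos gaps N p =
  _/_ ((ℤ.- + 1) ℤ.^ m ℤ.* + (p !) ℤ.* 𝒞 ds gaps N (m ℕ.+ p))
      (πm ds ℕ.* (m ℕ.+ p) !)
      {{m*n≢0 (πm ds) ((m ℕ.+ p) !) {{πm-nonZero ds pos}} {{(m ℕ.+ p) !≢0}}}}

G : List ℕ → ℕ → ℚ
G gaps r = List.foldr ℚ._+_ 0ℚ (map (λ g → ℕ→ℚ (g ℕ.^ r)) gaps)

σ : ∀ {m} → Vec ℕ m → ℕ → ℚ
σ ds k = ℕ→ℚ (Vec.sum (Vec.map (λ d → d ℕ.^ k) ds))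

δ : ∀ {m} → Vec ℕ m → ℕ → ℚ
δ ds k = (σ ds k ℚ.- 1ℚ) ℚ.* (_/_ (+ 1) (2 ℕ.^ k) {{Data.Nat.Properties.m^n≢0 2 k}})
  where import Data.Nat.Properties

-- Since log ∏_i (e^{x_i t}-1)/(x_i t) = Σ_k ℓ_k (Σ_i x_i^k) t^k, where
-- ℓ_k = [u^k] log((e^u - 1)/u), the unique polynomial T_n is
--   T_n(s_1,…,s_n) = n! [t^n] exp( Σ_{k≥1} ℓ_k s_k t^k ).
-- We compute the power-series log and exp by the standard recurrences
-- (f' = f·(log f)',  E' = L'·E).

at : List ℚ → ℕ → ℚ
at [] _ = 0ℚ
at (x ∷ xs) zero = x
at (x ∷ xs) (suc n) = at xs n

-- f_k = [u^k] (e^u - 1)/u = 1/(k+1)!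
fCoeff : ℕ → ℚ
fCoeff k = _/_ (+ 1) (suc k !) {{suc k !≢0}}

inv : ℕ → ℚ
inv n = + 1 / suc n

-- [ℓ_0, …, ℓ_n] with g = log f:  n g_n = n f_n - Σ_{j=1}^{n-1} j g_j f_{n-j}
logList : ℕ → List ℚ
logList zero = [ 0ℚ ]
logList (suc n) = gs ++ [ fCoeff (suc n) ℚ.- inv n ℚ.*
                     Σℚ< (suc n) (λ j → ℕ→ℚ j ℚ.* at gs j ℚ.* fCoeff (suc n ℕ.∸ j)) ]
  where gs = logList n

-- [E_0, …, E_n] with E = exp(L), L_k = ℓ_k s_k (k ≥ 1), L_0 = 0:
-- E_0 = 1, n E_n = Σ_{k=1}^n k L_k E_{n-k}
expList : (ℕ → ℚ) → ℕ → List ℚ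
expList L zero = [ 1ℚ ]
expList L (suc n) = es ++ [ inv n ℚ.*
                       Σℚ< (suc (suc n)) (λ k → ℕ→ℚ k ℚ.* L k ℚ.* at es (suc n ℕ.∸ k)) ]
  where es = expList L n

-- T_n evaluated at (s_1, …, s_n)  (s_0 is ignored)
T : ℕ → (ℕ → ℚ) → ℚ
T n s = ℕ→ℚ (n !) ℚ.* at (expList L n) n
  where
  L : ℕ → ℚ
  L zero = 0ℚ
  L (suc k) = at (logList n) (suc k) ℚ.* s (suc k)

-- Substitute X = e^t into the Hilbert numerator
--   Q(X) = ∏ᵢ (1 − X^{dᵢ}) · (1/(1 − X) − ∑_{g ∈ Δ} X^g).
-- The coefficient of t^n/n! in Q(e^t) is ∑_k k^n Q_k = −𝒞_n for n ≥ 1. On the other side,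
-- 1 − e^{dt} = −d t F(dt) with F(u) = (e^u − 1)/u, and (1 − e^{d₁t})/(1 − e^t) = d₁ F(d₁t)/F(t), so
--   Q(e^t) = −(−1)^m π_m t^{m−1} (∏ᵢ F(dᵢt)/F(t) + t ∏ᵢ F(dᵢt) ∑_{g ∈ Δ} e^{gt}).
-- Writing log F(u) = ∑_k ℓ_k u^k, the product ∏ᵢ F(dᵢt) = exp ∑_k ℓ_k σ_k t^k has coefficients
-- T_n(σ)/n!, and ∏ᵢ F(dᵢt)/F(t) = exp ∑_k ℓ_k δ_k (2t)^k has coefficients 2^n T_n(δ)/n!.
-- Comparing coefficients of t^{m+p} gives the formula. Exponentials of power series are handled
-- through the equation θX = θA·X (θ = t d/dt), whose solution with X₀ = 1 is unique.

module Submission where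

open import Defs
open import Data.Nat using (ℕ; suc; _≤_; _<_; _∸_; _^_)
open import Data.Nat.Combinatorics using (_C_)
open import Data.Integer using (+_)
open import Data.Rational using (_+_; _*_)
open import Data.List using (List)
open import Data.List.Membership.Propositional using (_∈_)
open import Data.List.Relation.Unary.Unique.Propositional using (Unique)
open import Data.Vec using (Vec)
open import Data.Vec.Relation.Unary.All using (All)
open import Relation.Binary.PropositionalEquality using (_≡_)
open import Relation.Nullary using (¬_)

open import Level using (0ℓ)
open import Function using (_∘_)
open import Data.Bool using (Bool; true; false; if_then_else_; _∨_)
open import Data.Empty using (⊥-elim)
open import Data.Product using (_×_; _,_; ∃-syntax)
open import Data.Sum using (inj₁; inj₂)
open import Data.Nat as ℕ using (zero; NonZero; _!; z≤n; s≤s)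
import Data.Nat.Properties as ℕP
open import Data.Nat.Combinatorics using (nCk≡n!/k![n-k]!; k![n∸k]!∣n!)
open import Data.Nat.DivMod using (m/n*n≡m)
open import Data.Nat.ListAction using (sum)
open import Data.Integer as ℤ using (ℤ)
import Data.Integer.Properties as ℤP
open import Data.Rational as ℚ using (ℚ; 0ℚ; 1ℚ; -_; _-_)
import Data.Rational.Properties as ℚP
import Data.Rational.Unnormalised as ℚᵘ
import Data.Rational.Unnormalised.Properties as ℚᵘP
import Data.List as List
open import Data.List using ([]; _∷_)
import Data.List.Properties as ListP
open import Data.List.Membership.DecPropositional (ℕ._≟_) using (_∈?_)
open import Data.List.Relation.Unary.Any using (here; there)
open import Data.List.Relation.Unary.All.Properties using (All¬⇒¬Any)
open import Data.List.Relation.Unary.AllPairs using (_∷_)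
import Data.Vec as Vec
open import Data.Vec using ([]; _∷_)
open import Relation.Binary.Bundles using (Setoid)
open import Relation.Binary.PropositionalEquality
  using (refl; sym; trans; cong; cong₂; subst; _≢_; _≗_; _→-setoid_; module ≡-Reasoning)
import Relation.Binary.Reasoning.Setoid as SetoidReasoning
open import Relation.Nullary.Decidable using (Dec; dec⇒maybe; does; yes; no)
import Tactic.RingSolver.Core.AlmostCommutativeRing as ACR
open import Tactic.RingSolver using (solve-∀)

ℚ-ring : ACR.AlmostCommutativeRing 0ℓ 0ℓ
ℚ-ring = ACR.fromCommutativeRing ℚP.+-*-commutativeRing (λ x → dec⇒maybe (0ℚ ℚP.≟ x))

fromℚᵘ-homo-+ : ∀ p q → ℚ.fromℚᵘ (p ℚᵘ.+ q) ≡ ℚ.fromℚᵘ p + ℚ.fromℚᵘ q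
fromℚᵘ-homo-+ p q = ℚP.toℚᵘ-injective (ℚᵘP.≃-sym (ℚᵘP.≃-trans (ℚP.toℚᵘ-homo-+ (ℚ.fromℚᵘ p) (ℚ.fromℚᵘ q))
  (ℚᵘP.≃-trans (ℚᵘP.+-cong (ℚP.toℚᵘ-fromℚᵘ p) (ℚP.toℚᵘ-fromℚᵘ q)) (ℚᵘP.≃-sym (ℚP.toℚᵘ-fromℚᵘ _)))))

fromℚᵘ-homo-* : ∀ p q → ℚ.fromℚᵘ (p ℚᵘ.* q) ≡ ℚ.fromℚᵘ p * ℚ.fromℚᵘ q
fromℚᵘ-homo-* p q = ℚP.toℚᵘ-injective (ℚᵘP.≃-sym (ℚᵘP.≃-trans (ℚP.toℚᵘ-homo-* (ℚ.fromℚᵘ p) (ℚ.fromℚᵘ q))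
  (ℚᵘP.≃-trans (ℚᵘP.*-cong (ℚP.toℚᵘ-fromℚᵘ p) (ℚP.toℚᵘ-fromℚᵘ q)) (ℚᵘP.≃-sym (ℚP.toℚᵘ-fromℚᵘ _)))))

/-cancel : ∀ i j m n .{{_ : NonZero m}} .{{_ : NonZero n}} → i ℤ.* + n ≡ j ℤ.* + m → i ℚ./ m ≡ j ℚ./ n
/-cancel i j (suc m) (suc n) eq = ℚP.fromℚᵘ-cong {ℚᵘ.mkℚᵘ i m} {ℚᵘ.mkℚᵘ j n} (ℚᵘ.*≡* eq)

/-homo-* : ∀ i j m n .{{_ : NonZero m}} .{{_ : NonZero n}} →
           ((i ℤ.* j) ℚ./ (m ℕ.* n)) {{ℕP.m*n≢0 m n}} ≡ (i ℚ./ m) * (j ℚ./ n)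
/-homo-* i j (suc m) (suc n) = fromℚᵘ-homo-* (ℚᵘ.mkℚᵘ i m) (ℚᵘ.mkℚᵘ j n)

-- ℤ→ℚ i = i / 1 is definitionally ℚ.fromℚᵘ (mkℚᵘ i 0).
ℤ→ℚ-homo-+ : ∀ x y → ℤ→ℚ (x ℤ.+ y) ≡ ℤ→ℚ x + ℤ→ℚ y
ℤ→ℚ-homo-+ x y = trans (cong (ℚ._/ 1) (sym (cong₂ ℤ._+_ (ℤP.*-identityʳ x) (ℤP.*-identityʳ y))))
                        (fromℚᵘ-homo-+ (ℚᵘ.mkℚᵘ x 0) (ℚᵘ.mkℚᵘ y 0))

ℤ→ℚ-homo-* : ∀ x y → ℤ→ℚ (x ℤ.* y) ≡ ℤ→ℚ x * ℤ→ℚ y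
ℤ→ℚ-homo-* x y = fromℚᵘ-homo-* (ℚᵘ.mkℚᵘ x 0) (ℚᵘ.mkℚᵘ y 0)

ℤ→ℚ-homo‿- : ∀ x → ℤ→ℚ (ℤ.- x) ≡ - ℤ→ℚ x
ℤ→ℚ-homo‿- (+ zero) = refl
ℤ→ℚ-homo‿- ℤ.+[1+ n ] = refl
ℤ→ℚ-homo‿- ℤ.-[1+ n ] = neg-involutive (ℤ→ℚ (+ suc n))
  where
  neg-involutive : ∀ x → x ≡ - - x
  neg-involutive = solve-∀ ℚ-ring

ℕ→ℚ-homo-+ : ∀ m n → ℕ→ℚ (m ℕ.+ n) ≡ ℕ→ℚ m + ℕ→ℚ n
ℕ→ℚ-homo-+ m n = trans (cong ℤ→ℚ (ℤP.pos-+ m n)) (ℤ→ℚ-homo-+ (+ m) (+ n))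

ℕ→ℚ-homo-* : ∀ m n → ℕ→ℚ (m ℕ.* n) ≡ ℕ→ℚ m * ℕ→ℚ n
ℕ→ℚ-homo-* m n = trans (cong ℤ→ℚ (ℤP.pos-* m n)) (ℤ→ℚ-homo-* (+ m) (+ n))

1/ℕ : (n : ℕ) → .{{NonZero n}} → ℚ
1/ℕ n = + 1 ℚ./ n

n*[1/n]≡1 : ∀ n .{{_ : NonZero n}} → ℕ→ℚ n * 1/ℕ n ≡ 1ℚ
n*[1/n]≡1 n = trans (sym (/-homo-* (+ n) (+ 1) 1 n)) (/-cancel (+ n ℤ.* + 1) (+ 1) (1 ℕ.* n) 1 {{ℕP.m*n≢0 1 n}} (begin
  + n ℤ.* + 1 ℤ.* + 1  ≡⟨ trans (ℤP.*-identityʳ _) (ℤP.*-identityʳ _) ⟩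
  + n                  ≡⟨ cong +_ (sym (ℕP.*-identityˡ n)) ⟩
  + (1 ℕ.* n)          ≡⟨ sym (ℤP.*-identityˡ _) ⟩
  + 1 ℤ.* + (1 ℕ.* n)  ∎))
  where open ≡-Reasoning

1/ℕ-homo-* : ∀ m n .{{_ : NonZero m}} .{{_ : NonZero n}} → 1/ℕ (m ℕ.* n) {{ℕP.m*n≢0 m n}} ≡ 1/ℕ m * 1/ℕ n
1/ℕ-homo-* m n = /-homo-* (+ 1) (+ 1) m n

/≡*1/ℕ : ∀ i n .{{_ : NonZero n}} → i ℚ./ n ≡ ℤ→ℚ i * 1/ℕ n
/≡*1/ℕ i n = trans (/-cancel i (i ℤ.* + 1) n (1 ℕ.* n) {{_}} {{ℕP.m*n≢0 1 n}}
                      (cong₂ ℤ._*_ (sym (ℤP.*-identityʳ i)) (cong +_ (ℕP.*-identityˡ n))))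
                   (/-homo-* i (+ 1) 1 n)

*-cancelˡ-suc : ∀ n {a b} → ℕ→ℚ (suc n) * a ≡ ℕ→ℚ (suc n) * b → a ≡ b
*-cancelˡ-suc n {a} {b} eq = begin
  a                                 ≡⟨ unscale a ⟨
  1/ℕ (suc n) * (ℕ→ℚ (suc n) * a)   ≡⟨ cong (1/ℕ (suc n) *_) eq ⟩
  1/ℕ (suc n) * (ℕ→ℚ (suc n) * b)   ≡⟨ unscale b ⟩
  b                                 ∎
  where
  open ≡-Reasoning
  unscale : ∀ x → 1/ℕ (suc n) * (ℕ→ℚ (suc n) * x) ≡ x
  unscale x = trans (sym (ℚP.*-assoc (1/ℕ (suc n)) (ℕ→ℚ (suc n)) x))
              (trans (cong (_* x) (trans (ℚP.*-comm (1/ℕ (suc n)) (ℕ→ℚ (suc n))) (n*[1/n]≡1 (suc n))))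
                     (ℚP.*-identityˡ x))

∑ : ℕ → (ℕ → ℚ) → ℚ
∑ zero    f = 0ℚ
∑ (suc n) f = f 0 + ∑ n (f ∘ suc)

foldr-applyUpTo≡∑ : ∀ n (f : ℕ → ℚ) → List.foldr _+_ 0ℚ (List.applyUpTo f n) ≡ ∑ n f
foldr-applyUpTo≡∑ zero    f = refl
foldr-applyUpTo≡∑ (suc n) f = cong (_+_ (f 0)) (foldr-applyUpTo≡∑ n (f ∘ suc))

Σℚ<≡∑ : ∀ n f → Σℚ< n f ≡ ∑ n f
Σℚ<≡∑ n f = trans (cong (List.foldr _+_ 0ℚ) (ListP.map-upTo f n)) (foldr-applyUpTo≡∑ n f)

ℤ→ℚ-foldr-applyUpTo : ∀ n (f : ℕ → ℤ) →
  ℤ→ℚ (List.foldr ℤ._+_ (+ 0) (List.applyUpTo f n)) ≡ ∑ n (ℤ→ℚ ∘ f)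
ℤ→ℚ-foldr-applyUpTo zero    f = refl
ℤ→ℚ-foldr-applyUpTo (suc n) f = trans (ℤ→ℚ-homo-+ (f 0) _) (cong (_+_ (ℤ→ℚ (f 0))) (ℤ→ℚ-foldr-applyUpTo n (f ∘ suc)))

ℤ→ℚ-Σℤ≤ : ∀ n f → ℤ→ℚ (Σℤ≤ n f) ≡ ∑ (suc n) (ℤ→ℚ ∘ f)
ℤ→ℚ-Σℤ≤ n f = trans (cong (λ xs → ℤ→ℚ (List.foldr ℤ._+_ (+ 0) xs)) (ListP.map-upTo f (suc n)))
                     (ℤ→ℚ-foldr-applyUpTo (suc n) f)

∑-cong-< : ∀ n {f g : ℕ → ℚ} → (∀ i → i < n → f i ≡ g i) → ∑ n f ≡ ∑ n g
∑-cong-< zero    eq = refl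
∑-cong-< (suc n) eq = cong₂ _+_ (eq 0 (s≤s z≤n)) (∑-cong-< n (λ i i<n → eq (suc i) (s≤s i<n)))

∑-cong : ∀ n {f g : ℕ → ℚ} → f ≗ g → ∑ n f ≡ ∑ n g
∑-cong n eq = ∑-cong-< n (λ i _ → eq i)

∑-zero : ∀ n (f : ℕ → ℚ) → (∀ i → i < n → f i ≡ 0ℚ) → ∑ n f ≡ 0ℚ
∑-zero n f eq = trans (∑-cong-< n eq) (∑-const-0 n)
  where
  ∑-const-0 : ∀ n → ∑ n (λ _ → 0ℚ) ≡ 0ℚ
  ∑-const-0 zero    = refl
  ∑-const-0 (suc n) = trans (ℚP.+-identityˡ _) (∑-const-0 n)

∑-distrib-+ : ∀ n (f g : ℕ → ℚ) → ∑ n (λ i → f i + g i) ≡ ∑ n f + ∑ n g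
∑-distrib-+ zero    f g = refl
∑-distrib-+ (suc n) f g = trans (cong (_+_ (f 0 + g 0)) (∑-distrib-+ n (f ∘ suc) (g ∘ suc)))
                               (interchange (f 0) (g 0) (∑ n (f ∘ suc)) (∑ n (g ∘ suc)))
  where
  interchange : ∀ a b c d → (a + b) + (c + d) ≡ (a + c) + (b + d)
  interchange = solve-∀ ℚ-ring

∑-*ˡ : ∀ n c (f : ℕ → ℚ) → ∑ n (λ i → c * f i) ≡ c * ∑ n f
∑-*ˡ zero    c f = sym (ℚP.*-zeroʳ c)
∑-*ˡ (suc n) c f = trans (cong (_+_ (c * f 0)) (∑-*ˡ n c (f ∘ suc))) (sym (ℚP.*-distribˡ-+ c (f 0) _))

∑-*ʳ : ∀ n c (f : ℕ → ℚ) → ∑ n (λ i → f i * c) ≡ ∑ n f * c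
∑-*ʳ n c f = trans (∑-cong n (λ i → ℚP.*-comm (f i) c)) (trans (∑-*ˡ n c f) (ℚP.*-comm c _))

∑-neg : ∀ n (f : ℕ → ℚ) → ∑ n (λ i → - f i) ≡ - ∑ n f
∑-neg zero    f = refl
∑-neg (suc n) f = trans (cong (_+_ (- f 0)) (∑-neg n (f ∘ suc))) (sym (ℚP.neg-distrib-+ (f 0) _))

∑-suc : ∀ n (f : ℕ → ℚ) → ∑ (suc n) f ≡ ∑ n f + f n
∑-suc zero    f = trans (ℚP.+-identityʳ (f 0)) (sym (ℚP.+-identityˡ (f 0)))
∑-suc (suc n) f = trans (cong (_+_ (f 0)) (∑-suc n (f ∘ suc))) (sym (ℚP.+-assoc (f 0) _ _))

∑-+ : ∀ a b (f : ℕ → ℚ) → ∑ (a ℕ.+ b) f ≡ ∑ a f + ∑ b (λ i → f (a ℕ.+ i))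
∑-+ zero    b f = sym (ℚP.+-identityˡ _)
∑-+ (suc a) b f = trans (cong (_+_ (f 0)) (∑-+ a b (f ∘ suc))) (sym (ℚP.+-assoc (f 0) _ _))

∑-truncate : ∀ b n (f : ℕ → ℚ) → b ≤ n → (∀ i → b ≤ i → f i ≡ 0ℚ) → ∑ n f ≡ ∑ b f
∑-truncate b n f b≤n tail-zero = begin
  ∑ n f                                   ≡⟨ cong (λ k → ∑ k f) (ℕP.m+[n∸m]≡n b≤n) ⟨
  ∑ (b ℕ.+ (n ∸ b)) f                     ≡⟨ ∑-+ b (n ∸ b) f ⟩
  ∑ b f + ∑ (n ∸ b) (λ i → f (b ℕ.+ i))   ≡⟨ cong (_+_ (∑ b f)) (∑-zero (n ∸ b) _ (λ i _ → tail-zero (b ℕ.+ i) (ℕP.m≤m+n b i))) ⟩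
  ∑ b f + 0ℚ                              ≡⟨ ℚP.+-identityʳ (∑ b f) ⟩
  ∑ b f                                   ∎
  where open ≡-Reasoning

∑-single : ∀ n j (f : ℕ → ℚ) → j < n → (∀ i → i ≢ j → f i ≡ 0ℚ) → ∑ n f ≡ f j
∑-single (suc n) zero    f _         others = trans (cong (_+_ (f 0)) (∑-zero n (f ∘ suc) (λ i _ → others (suc i) (λ ())))) (ℚP.+-identityʳ (f 0))
∑-single (suc n) (suc j) f (s≤s j<n) others = trans (cong (_+ ∑ n (f ∘ suc)) (others 0 (λ ()))) (trans (ℚP.+-identityˡ _)
  (∑-single n j (f ∘ suc) j<n (λ i i≢j → others (suc i) (i≢j ∘ ℕP.suc-injective))))

∑-telescope : ∀ n (f : ℕ → ℚ) → ∑ n (λ k → f (suc k) - f k) ≡ f n - f 0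
∑-telescope zero    f = sym (ℚP.+-inverseʳ (f 0))
∑-telescope (suc n) f = trans (∑-suc n _) (trans (cong (_+ (f (suc n) - f n)) (∑-telescope n f)) (collapse (f n) (f 0) (f (suc n))))
  where
  collapse : ∀ a b c → (a - b) + (c - a) ≡ c - b
  collapse = solve-∀ ℚ-ring

Series : Set
Series = ℕ → ℚ

open Setoid (ℕ →-setoid ℚ) using () renaming (sym to ≗-sym; trans to ≗-trans)
module ≗-Reasoning = SetoidReasoning (ℕ →-setoid ℚ)

infixl 6 _⊕_
infixl 7 _⊛_ _•_
infix  8 ⊖_

_⊕_ : Series → Series → Series
(A ⊕ B) n = A n + B n

⊖_ : Series → Series
(⊖ A) n = - A n

_•_ : ℚ → Series → Series
(c • A) n = c * A n

𝟘 : Series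
𝟘 _ = 0ℚ

𝟙 : Series
𝟙 zero    = 1ℚ
𝟙 (suc n) = 0ℚ

tail : Series → Series
tail A n = A (suc n)

-- multiplication by t^d
shift : ℕ → Series → Series
shift zero    A n       = A n
shift (suc d) A zero    = 0ℚ
shift (suc d) A (suc n) = shift d A n

-- the Euler operator t d/dt
θ : Series → Series
θ A n = ℕ→ℚ n * A n

_⊛_ : Series → Series → Series
(A ⊛ B) zero    = A 0 * B 0
(A ⊛ B) (suc n) = A 0 * B (suc n) + (tail A ⊛ B) n

⊛-≡-∑ : ∀ A B n → (A ⊛ B) n ≡ ∑ (suc n) (λ i → A i * B (n ∸ i))
⊛-≡-∑ A B zero    = sym (ℚP.+-identityʳ (A 0 * B 0))
⊛-≡-∑ A B (suc n) = cong (_+_ (A 0 * B (suc n))) (⊛-≡-∑ (tail A) B n)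

⊛-congˡ : ∀ {A A′} B → A ≗ A′ → A ⊛ B ≗ A′ ⊛ B
⊛-congˡ B eq zero    = cong (_* B 0) (eq 0)
⊛-congˡ B eq (suc n) = cong₂ _+_ (cong (_* B (suc n)) (eq 0)) (⊛-congˡ B (eq ∘ suc) n)

⊛-congʳ-≤ : ∀ n A {B B′} → (∀ k → k ≤ n → B k ≡ B′ k) → (A ⊛ B) n ≡ (A ⊛ B′) n
⊛-congʳ-≤ zero    A eq = cong (A 0 *_) (eq 0 z≤n)
⊛-congʳ-≤ (suc n) A eq = cong₂ _+_ (cong (A 0 *_) (eq (suc n) ℕP.≤-refl))
                                   (⊛-congʳ-≤ n (tail A) (λ k k≤n → eq k (ℕP.m≤n⇒m≤1+n k≤n)))

⊛-congʳ : ∀ A {B B′} → B ≗ B′ → A ⊛ B ≗ A ⊛ B′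
⊛-congʳ A eq n = ⊛-congʳ-≤ n A (λ k _ → eq k)

⊛-cong : ∀ {A A′ B B′} → A ≗ A′ → B ≗ B′ → A ⊛ B ≗ A′ ⊛ B′
⊛-cong {A′ = A′} {B = B} eqA eqB = ≗-trans (⊛-congˡ B eqA) (⊛-congʳ A′ eqB)

⊛-distribʳ-⊕ : ∀ A B D → (A ⊕ B) ⊛ D ≗ A ⊛ D ⊕ B ⊛ D
⊛-distribʳ-⊕ A B D zero    = ℚP.*-distribʳ-+ (D 0) (A 0) (B 0)
⊛-distribʳ-⊕ A B D (suc n) = trans (cong (_+_ ((A 0 + B 0) * D (suc n))) (⊛-distribʳ-⊕ (tail A) (tail B) D n))
                                   (regroup (A 0) (B 0) (D (suc n)) _ _)
  where
  regroup : ∀ a b c x y → (a + b) * c + (x + y) ≡ (a * c + x) + (b * c + y)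
  regroup = solve-∀ ℚ-ring

•-⊛-assoc : ∀ c A B → (c • A) ⊛ B ≗ c • (A ⊛ B)
•-⊛-assoc c A B zero    = ℚP.*-assoc c (A 0) (B 0)
•-⊛-assoc c A B (suc n) = trans (cong (_+_ (c * A 0 * B (suc n))) (•-⊛-assoc c (tail A) B n))
                                (factor c (A 0) (B (suc n)) _)
  where
  factor : ∀ c a b x → c * a * b + c * x ≡ c * (a * b + x)
  factor = solve-∀ ℚ-ring

⊖-⊛ : ∀ A B → (⊖ A) ⊛ B ≗ ⊖ (A ⊛ B)
⊖-⊛ A B zero    = sym (ℚP.neg-distribˡ-* (A 0) (B 0))
⊖-⊛ A B (suc n) = trans (cong (_+_ (- A 0 * B (suc n))) (⊖-⊛ (tail A) B n)) (factor (A 0) (B (suc n)) _)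
  where
  factor : ∀ a b x → - a * b + - x ≡ - (a * b + x)
  factor = solve-∀ ℚ-ring

⊛-zeroˡ : ∀ A → 𝟘 ⊛ A ≗ 𝟘
⊛-zeroˡ A zero    = ℚP.*-zeroˡ (A 0)
⊛-zeroˡ A (suc n) = cong₂ _+_ (ℚP.*-zeroˡ (A (suc n))) (⊛-zeroˡ A n)

⊛-identityˡ : ∀ A → 𝟙 ⊛ A ≗ A
⊛-identityˡ A zero    = ℚP.*-identityˡ (A 0)
⊛-identityˡ A (suc n) = trans (cong₂ _+_ (ℚP.*-identityˡ (A (suc n))) (⊛-zeroˡ A n)) (ℚP.+-identityʳ (A (suc n)))

shift-cong : ∀ d {A B} → A ≗ B → shift d A ≗ shift d B
shift-cong zero    eq n       = eq n
shift-cong (suc d) eq zero    = refl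
shift-cong (suc d) eq (suc n) = shift-cong d eq n

shift-shift : ∀ a b A → shift a (shift b A) ≗ shift (a ℕ.+ b) A
shift-shift zero    b A n       = refl
shift-shift (suc a) b A zero    = refl
shift-shift (suc a) b A (suc n) = shift-shift a b A n

shift-• : ∀ d c A → shift d (c • A) ≗ c • shift d A
shift-• zero    c A n       = refl
shift-• (suc d) c A zero    = sym (ℚP.*-zeroʳ c)
shift-• (suc d) c A (suc n) = shift-• d c A n

•-cong : ∀ c {A B} → A ≗ B → c • A ≗ c • B
•-cong c eq n = cong (c *_) (eq n)

shift-⊛ : ∀ d A B → shift d A ⊛ B ≗ shift d (A ⊛ B)
shift-⊛ zero    A B n       = refl
shift-⊛ (suc d) A B zero    = ℚP.*-zeroˡ (B 0)
shift-⊛ (suc d) A B (suc n) = trans (cong (_+ (shift d A ⊛ B) n) (ℚP.*-zeroˡ (B (suc n))))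
                                   (trans (ℚP.+-identityˡ _) (shift-⊛ d A B n))

⊛-comm : ∀ A B → A ⊛ B ≗ B ⊛ A
⊛-comm A B zero    = ℚP.*-comm (A 0) (B 0)
⊛-comm A B (suc n) = trans (cong₂ _+_ (ℚP.*-comm (A 0) (B (suc n))) (⊛-comm (tail A) B n)) (sym (⊛-suc-tailʳ n B A))
  where
  ⊛-suc-tailʳ : ∀ n A B → (A ⊛ B) (suc n) ≡ A (suc n) * B 0 + (A ⊛ tail B) n
  ⊛-suc-tailʳ zero    A B = ℚP.+-comm (A 0 * B 1) (A 1 * B 0)
  ⊛-suc-tailʳ (suc n) A B = trans (cong (_+_ (A 0 * B (suc (suc n)))) (⊛-suc-tailʳ n (tail A) B))
                                  (swap (A 0 * B (suc (suc n))) (A (suc (suc n)) * B 0) _)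
    where
    swap : ∀ x y z → x + (y + z) ≡ y + (x + z)
    swap = solve-∀ ℚ-ring

⊛-assoc : ∀ A B D → (A ⊛ B) ⊛ D ≗ A ⊛ (B ⊛ D)
⊛-assoc A B D zero    = ℚP.*-assoc (A 0) (B 0) (D 0)
⊛-assoc A B D (suc n) = begin
  A 0 * B 0 * D (suc n) + (tail (A ⊛ B) ⊛ D) n
    ≡⟨ cong (_+_ (A 0 * B 0 * D (suc n))) (⊛-distribʳ-⊕ (A 0 • tail B) (tail A ⊛ B) D n) ⟩
  A 0 * B 0 * D (suc n) + (((A 0 • tail B) ⊛ D) n + ((tail A ⊛ B) ⊛ D) n)
    ≡⟨ cong (_+_ (A 0 * B 0 * D (suc n))) (cong₂ _+_ (•-⊛-assoc (A 0) (tail B) D n) (⊛-assoc (tail A) B D n)) ⟩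
  A 0 * B 0 * D (suc n) + (A 0 * (tail B ⊛ D) n + (tail A ⊛ (B ⊛ D)) n)
    ≡⟨ factor (A 0) (B 0) (D (suc n)) _ _ ⟩
  A 0 * (B 0 * D (suc n) + (tail B ⊛ D) n) + (tail A ⊛ (B ⊛ D)) n
    ∎
  where
  open ≡-Reasoning
  factor : ∀ a b c x y → a * b * c + (a * x + y) ≡ a * (b * c + x) + y
  factor = solve-∀ ℚ-ring

⊛-distribˡ-⊕ : ∀ A B D → A ⊛ (B ⊕ D) ≗ A ⊛ B ⊕ A ⊛ D
⊛-distribˡ-⊕ A B D n = trans (⊛-comm A (B ⊕ D) n)
  (trans (⊛-distribʳ-⊕ B D A n) (cong₂ _+_ (⊛-comm B A n) (⊛-comm D A n)))

⊛-•-comm : ∀ c A B → A ⊛ (c • B) ≗ c • (A ⊛ B)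
⊛-•-comm c A B n = trans (⊛-comm A (c • B) n) (trans (•-⊛-assoc c B A n) (cong (c *_) (⊛-comm B A n)))

⊛-⊖ : ∀ A B → A ⊛ (⊖ B) ≗ ⊖ (A ⊛ B)
⊛-⊖ A B n = trans (⊛-comm A (⊖ B) n) (trans (⊖-⊛ B A n) (cong -_ (⊛-comm B A n)))

⊛-shift : ∀ d A B → A ⊛ shift d B ≗ shift d (A ⊛ B)
⊛-shift d A B = ≗-trans (⊛-comm A (shift d B)) (≗-trans (shift-⊛ d B A) (shift-cong d (⊛-comm B A)))

shift-⊛-shift : ∀ a b A B → shift a A ⊛ shift b B ≗ shift (a ℕ.+ b) (A ⊛ B)
shift-⊛-shift a b A B = ≗-trans (shift-⊛ a A (shift b B)) (≗-trans (shift-cong a (⊛-shift b A B)) (shift-shift a b (A ⊛ B)))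

⊛-swap : ∀ A B D → A ⊛ (B ⊛ D) ≗ B ⊛ (A ⊛ D)
⊛-swap A B D n = trans (sym (⊛-assoc A B D n)) (trans (⊛-congˡ D (⊛-comm A B) n) (⊛-assoc B A D n))

⊛-zeroʳ : ∀ A → A ⊛ 𝟘 ≗ 𝟘
⊛-zeroʳ A = ≗-trans (⊛-comm A 𝟘) (⊛-zeroˡ A)

⊛-∑ : ∀ K A (B : ℕ → Series) → A ⊛ (λ n → ∑ K (λ i → B i n)) ≗ (λ n → ∑ K (λ i → (A ⊛ B i) n))
⊛-∑ zero    A B = ⊛-zeroʳ A
⊛-∑ (suc K) A B n = trans (⊛-distribˡ-⊕ A (B 0) (λ n → ∑ K (λ i → B (suc i) n)) n)
                          (cong (_+_ ((A ⊛ B 0) n)) (⊛-∑ K A (B ∘ suc) n))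

shift-+ : ∀ k A n → shift k A (k ℕ.+ n) ≡ A n
shift-+ zero    A n = refl
shift-+ (suc k) A n = shift-+ k A n

θ-⊕ : ∀ A B → θ (A ⊕ B) ≗ θ A ⊕ θ B
θ-⊕ A B n = ℚP.*-distribˡ-+ (ℕ→ℚ n) (A n) (B n)

-- Leibniz rule: split the weight n of each term A_i B_{n-i} as i + (n - i).
θ-⊛ : ∀ A B → θ (A ⊛ B) ≗ θ A ⊛ B ⊕ A ⊛ θ B
θ-⊛ A B n = begin
  ℕ→ℚ n * (A ⊛ B) n
    ≡⟨ cong (ℕ→ℚ n *_) (⊛-≡-∑ A B n) ⟩
  ℕ→ℚ n * ∑ (suc n) (λ i → A i * B (n ∸ i))
    ≡⟨ ∑-*ˡ (suc n) (ℕ→ℚ n) (λ i → A i * B (n ∸ i)) ⟨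
  ∑ (suc n) (λ i → ℕ→ℚ n * (A i * B (n ∸ i)))
    ≡⟨ ∑-cong-< (suc n) split-weight ⟩
  ∑ (suc n) (λ i → ℕ→ℚ i * A i * B (n ∸ i) + A i * (ℕ→ℚ (n ∸ i) * B (n ∸ i)))
    ≡⟨ ∑-distrib-+ (suc n) (λ i → ℕ→ℚ i * A i * B (n ∸ i)) (λ i → A i * (ℕ→ℚ (n ∸ i) * B (n ∸ i))) ⟩
  ∑ (suc n) (λ i → ℕ→ℚ i * A i * B (n ∸ i)) + ∑ (suc n) (λ i → A i * (ℕ→ℚ (n ∸ i) * B (n ∸ i)))
    ≡⟨ cong₂ _+_ (⊛-≡-∑ (θ A) B n) (⊛-≡-∑ A (θ B) n) ⟨
  (θ A ⊛ B) n + (A ⊛ θ B) n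
    ∎
  where
  open ≡-Reasoning
  split-weight : ∀ i → i < suc n →
    ℕ→ℚ n * (A i * B (n ∸ i)) ≡ ℕ→ℚ i * A i * B (n ∸ i) + A i * (ℕ→ℚ (n ∸ i) * B (n ∸ i))
  split-weight i i<1+n = begin
    ℕ→ℚ n * (A i * B (n ∸ i))                              ≡⟨ cong (λ k → ℕ→ℚ k * (A i * B (n ∸ i))) (ℕP.m+[n∸m]≡n (ℕP.≤-pred i<1+n)) ⟨
    ℕ→ℚ (i ℕ.+ (n ∸ i)) * (A i * B (n ∸ i))                ≡⟨ cong (_* (A i * B (n ∸ i))) (ℕ→ℚ-homo-+ i (n ∸ i)) ⟩
    (ℕ→ℚ i + ℕ→ℚ (n ∸ i)) * (A i * B (n ∸ i))              ≡⟨ distribute (ℕ→ℚ i) (ℕ→ℚ (n ∸ i)) (A i) (B (n ∸ i)) ⟩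
    ℕ→ℚ i * A i * B (n ∸ i) + A i * (ℕ→ℚ (n ∸ i) * B (n ∸ i)) ∎
    where
    distribute : ∀ x y a b → (x + y) * (a * b) ≡ x * a * b + a * (y * b)
    distribute = solve-∀ ℚ-ring

-- X = exp (A − A₀): the equation θX = θA·X with X₀ = 1 determines X
-- coefficient by coefficient.
IsExp : Series → Series → Set
IsExp A X = X 0 ≡ 1ℚ × θ X ≗ θ A ⊛ X

θ-exp-suc : ∀ {A X} → θ X ≗ θ A ⊛ X → ∀ n → ℕ→ℚ (suc n) * X (suc n) ≡ (tail (θ A) ⊛ X) n
θ-exp-suc {A} {X} θX n = trans (θX (suc n)) (drop-constant (A 0) (X (suc n)) _)
  where
  drop-constant : ∀ a x y → 0ℚ * a * x + y ≡ y
  drop-constant = solve-∀ ℚ-ring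

exp-unique : ∀ {A X Y} → IsExp A X → IsExp A Y → X ≗ Y
exp-unique {A} {X} {Y} (X₀ , θX) (Y₀ , θY) n = agree n n ℕP.≤-refl
  where
  agree : ∀ n k → k ≤ n → X k ≡ Y k
  agree zero    zero z≤n = trans X₀ (sym Y₀)
  agree (suc n) k  k≤1+n with ℕP.m≤n⇒m<n∨m≡n k≤1+n
  ... | inj₁ (s≤s k≤n) = agree n k k≤n
  ... | inj₂ refl      = *-cancelˡ-suc n (begin
    ℕ→ℚ (suc n) * X (suc n)   ≡⟨ θ-exp-suc θX n ⟩
    (tail (θ A) ⊛ X) n        ≡⟨ ⊛-congʳ-≤ n (tail (θ A)) (agree n) ⟩
    (tail (θ A) ⊛ Y) n        ≡⟨ θ-exp-suc θY n ⟨
    ℕ→ℚ (suc n) * Y (suc n)   ∎)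
    where open ≡-Reasoning

IsExp-respˡ : ∀ {A A′ X} → (∀ n → A (suc n) ≡ A′ (suc n)) → IsExp A X → IsExp A′ X
IsExp-respˡ {A} {A′} {X} eq (X₀ , θX) = X₀ , ≗-trans θX (⊛-congˡ X θA≗θA′)
  where
  θA≗θA′ : θ A ≗ θ A′
  θA≗θA′ zero    = trans (ℚP.*-zeroˡ (A 0)) (sym (ℚP.*-zeroˡ (A′ 0)))
  θA≗θA′ (suc n) = cong (ℕ→ℚ (suc n) *_) (eq n)

exp-𝟘 : IsExp 𝟘 𝟙
exp-𝟘 = refl , λ n → trans (θ𝟙 n) (sym (trans (⊛-congˡ 𝟙 θ𝟘 n) (⊛-zeroˡ 𝟙 n)))
  where
  θ𝟙 : θ 𝟙 ≗ 𝟘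
  θ𝟙 zero    = refl
  θ𝟙 (suc n) = ℚP.*-zeroʳ (ℕ→ℚ (suc n))
  θ𝟘 : θ 𝟘 ≗ 𝟘
  θ𝟘 n = ℚP.*-zeroʳ (ℕ→ℚ n)

exp-⊕ : ∀ {A B X Y} → IsExp A X → IsExp B Y → IsExp (A ⊕ B) (X ⊛ Y)
exp-⊕ {A} {B} {X} {Y} (X₀ , θX) (Y₀ , θY) = trans (cong₂ _*_ X₀ Y₀) (ℚP.*-identityˡ 1ℚ) , (begin
  θ (X ⊛ Y)                         ≈⟨ θ-⊛ X Y ⟩
  θ X ⊛ Y ⊕ X ⊛ θ Y                 ≈⟨ (λ n → cong₂ _+_ (⊛-congˡ Y θX n) (⊛-congʳ X θY n)) ⟩
  (θ A ⊛ X) ⊛ Y ⊕ X ⊛ (θ B ⊛ Y)     ≈⟨ (λ n → cong₂ _+_ (⊛-assoc (θ A) X Y n) (⊛-swap X (θ B) Y n)) ⟩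
  θ A ⊛ (X ⊛ Y) ⊕ θ B ⊛ (X ⊛ Y)     ≈⟨ ⊛-distribʳ-⊕ (θ A) (θ B) (X ⊛ Y) ⟨
  (θ A ⊕ θ B) ⊛ (X ⊛ Y)             ≈⟨ ⊛-congˡ (X ⊛ Y) (θ-⊕ A B) ⟨
  θ (A ⊕ B) ⊛ (X ⊛ Y)               ∎)
  where open ≗-Reasoning

exp-inverse : ∀ {A X Y} → IsExp A X → IsExp (⊖ A) Y → X ⊛ Y ≗ 𝟙
exp-inverse {A} expX expY = exp-unique (IsExp-respˡ (λ n → ℚP.+-inverseʳ (A (suc n))) (exp-⊕ expX expY)) exp-𝟘

-- A(d t)
dilate : ℕ → Series → Series
dilate d A n = ℕ→ℚ (d ^ n) * A n

tail-dilate : ∀ d A → tail (dilate d A) ≗ ℕ→ℚ d • dilate d (tail A)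
tail-dilate d A n = trans (cong (_* A (suc n)) (ℕ→ℚ-homo-* d (d ^ n))) (ℚP.*-assoc (ℕ→ℚ d) _ _)

⊛-dilate : ∀ d A B → dilate d A ⊛ dilate d B ≗ dilate d (A ⊛ B)
⊛-dilate d A B zero    = regroup (A 0) (B 0)
  where
  regroup : ∀ a b → 1ℚ * a * (1ℚ * b) ≡ 1ℚ * (a * b)
  regroup = solve-∀ ℚ-ring
⊛-dilate d A B (suc n) = begin
  1ℚ * A 0 * (ℕ→ℚ (d ℕ.* d ^ n) * B (suc n)) + (tail (dilate d A) ⊛ dilate d B) n
    ≡⟨ cong₂ (λ x y → 1ℚ * A 0 * (x * B (suc n)) + y) (ℕ→ℚ-homo-* d (d ^ n)) (begin
         (tail (dilate d A) ⊛ dilate d B) n              ≡⟨ ⊛-congˡ (dilate d B) (tail-dilate d A) n ⟩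
         ((ℕ→ℚ d • dilate d (tail A)) ⊛ dilate d B) n   ≡⟨ •-⊛-assoc (ℕ→ℚ d) (dilate d (tail A)) (dilate d B) n ⟩
         ℕ→ℚ d * (dilate d (tail A) ⊛ dilate d B) n     ≡⟨ cong (ℕ→ℚ d *_) (⊛-dilate d (tail A) B n) ⟩
         ℕ→ℚ d * (ℕ→ℚ (d ^ n) * (tail A ⊛ B) n)         ∎) ⟩
  1ℚ * A 0 * (ℕ→ℚ d * ℕ→ℚ (d ^ n) * B (suc n)) + ℕ→ℚ d * (ℕ→ℚ (d ^ n) * (tail A ⊛ B) n)
    ≡⟨ factor (A 0) (B (suc n)) (ℕ→ℚ d) (ℕ→ℚ (d ^ n)) _ ⟩
  ℕ→ℚ d * ℕ→ℚ (d ^ n) * (A 0 * B (suc n) + (tail A ⊛ B) n)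
    ≡⟨ cong (_* (A 0 * B (suc n) + (tail A ⊛ B) n)) (ℕ→ℚ-homo-* d (d ^ n)) ⟨
  ℕ→ℚ (d ℕ.* d ^ n) * (A 0 * B (suc n) + (tail A ⊛ B) n)
    ∎
  where
  open ≡-Reasoning
  factor : ∀ a b c q x → 1ℚ * a * (c * q * b) + c * (q * x) ≡ c * q * (a * b + x)
  factor = solve-∀ ℚ-ring

exp-dilate : ∀ d {A X} → IsExp A X → IsExp (dilate d A) (dilate d X)
exp-dilate d {A} {X} (X₀ , θX) = trans (ℚP.*-identityˡ (X 0)) X₀ , λ n → begin
  ℕ→ℚ n * (ℕ→ℚ (d ^ n) * X n)            ≡⟨ swap (ℕ→ℚ (d ^ n)) (ℕ→ℚ n) (X n) ⟨
  ℕ→ℚ (d ^ n) * (ℕ→ℚ n * X n)            ≡⟨ cong (ℕ→ℚ (d ^ n) *_) (θX n) ⟩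
  ℕ→ℚ (d ^ n) * (θ A ⊛ X) n              ≡⟨ ⊛-dilate d (θ A) X n ⟨
  (dilate d (θ A) ⊛ dilate d X) n        ≡⟨ ⊛-congˡ (dilate d X) (λ k → swap (ℕ→ℚ (d ^ k)) (ℕ→ℚ k) (A k)) n ⟩
  (θ (dilate d A) ⊛ dilate d X) n        ∎
  where
  open ≡-Reasoning
  swap : ∀ a b x → a * (b * x) ≡ b * (a * x)
  swap = solve-∀ ℚ-ring

at-++ˡ : ∀ xs ys k → k < List.length xs → at (xs List.++ ys) k ≡ at xs k
at-++ˡ (x ∷ xs) ys zero    _         = refl
at-++ˡ (x ∷ xs) ys (suc k) (s≤s k<n) = at-++ˡ xs ys k k<n

at-snoc : ∀ xs y {n} → List.length xs ≡ n → at (xs List.++ List.[ y ]) n ≡ y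
at-snoc []       y refl = refl
at-snoc (x ∷ xs) y refl = at-snoc xs y refl

SnocChain : (ℕ → List ℚ) → Set
SnocChain xs = List.length (xs 0) ≡ 1 × (∀ n → ∃[ y ] xs (suc n) ≡ xs n List.++ List.[ y ])

length-SnocChain : ∀ {xs} → SnocChain xs → ∀ n → List.length (xs n) ≡ suc n
length-SnocChain (len₀ , _)    zero    = len₀
length-SnocChain {xs} chain@(_ , grow) (suc n) with grow n
... | y , eq = trans (cong List.length eq)
                     (trans (ListP.length-++ (xs n)) (trans (ℕP.+-comm _ 1) (cong suc (length-SnocChain chain n))))

at-SnocChain : ∀ {xs} → SnocChain xs → ∀ {k n} → k ≤ n → at (xs n) k ≡ at (xs k) k
at-SnocChain {xs} chain@(_ , grow) {k} {n} k≤n with ℕP.m≤n⇒m<n∨m≡n k≤n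
... | inj₂ refl = refl
... | inj₁ k<n  with n | k<n
...   | suc n′ | s≤s k≤n′ with grow n′
...     | y , eq = trans (cong (λ ys → at ys k) eq)
                         (trans (at-++ˡ (xs n′) List.[ y ] k (subst (k <_) (sym (length-SnocChain chain n′)) (s≤s k≤n′)))
                                (at-SnocChain chain k≤n′))

expList-chain : ∀ L → SnocChain (expList L)
expList-chain L = refl , λ n → _ , refl

logList-chain : SnocChain logList
logList-chain = refl , λ n → _ , refl

expSeries : (ℕ → ℚ) → Series
expSeries L n = at (expList L n) n

-- the coefficients of log F, where F u = (e^u − 1)/u
ℓ : Series
ℓ n = at (logList n) n

F : Series
F = fCoeff

[1+n]*inv : ∀ n x → ℕ→ℚ (suc n) * (inv n * x) ≡ x
[1+n]*inv n x = trans (sym (ℚP.*-assoc (ℕ→ℚ (suc n)) (inv n) x))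
                      (trans (cong (_* x) (n*[1/n]≡1 (suc n))) (ℚP.*-identityˡ x))

expSeries-isExp : ∀ L → IsExp L (expSeries L)
expSeries-isExp L = refl , θE
  where
  E = expSeries L
  annihilate : ∀ a x → 0ℚ * a * x ≡ 0ℚ
  annihilate = solve-∀ ℚ-ring
  θE : θ E ≗ θ L ⊛ E
  θE zero    = trans (ℚP.*-zeroˡ (E 0)) (sym (annihilate (L 0) (E 0)))
  θE (suc n) = begin
    ℕ→ℚ (suc n) * E (suc n)
      ≡⟨ cong (ℕ→ℚ (suc n) *_) (at-snoc (expList L n) _ (length-SnocChain (expList-chain L) n)) ⟩
    ℕ→ℚ (suc n) * (inv n * Σℚ< (suc (suc n)) term)
      ≡⟨ [1+n]*inv n (Σℚ< (suc (suc n)) term) ⟩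
    Σℚ< (suc (suc n)) term
      ≡⟨ Σℚ<≡∑ (suc (suc n)) term ⟩
    ∑ (suc (suc n)) term
      ≡⟨ ∑-cong (suc (suc n)) earlier-coefficients ⟩
    ∑ (suc (suc n)) (λ k → θ L k * E (suc n ∸ k))
      ≡⟨ ⊛-≡-∑ (θ L) E (suc n) ⟨
    (θ L ⊛ E) (suc n)
      ∎
    where
    open ≡-Reasoning
    term : ℕ → ℚ
    term k = ℕ→ℚ k * L k * at (expList L n) (suc n ∸ k)
    earlier-coefficients : ∀ k → term k ≡ θ L k * E (suc n ∸ k)
    earlier-coefficients zero    = trans (annihilate (L 0) _) (sym (annihilate (L 0) (E (suc n))))
    earlier-coefficients (suc k) = cong (θ L (suc k) *_) (at-SnocChain (expList-chain L) (ℕP.m∸n≤m n k))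

F-isExp : IsExp ℓ F
F-isExp = refl , θF
  where
  θF : θ F ≗ θ ℓ ⊛ F
  θF zero    = refl
  θF (suc n) = sym (begin
    (θ ℓ ⊛ F) (suc n)
      ≡⟨ ⊛-≡-∑ (θ ℓ) F (suc n) ⟩
    ∑ (suc (suc n)) term
      ≡⟨ ∑-suc (suc n) term ⟩
    ∑ (suc n) term + θ ℓ (suc n) * F (n ∸ n)
      ≡⟨ cong₂ (λ x k → x + ℕ→ℚ (suc n) * ℓ (suc n) * F k) (sym earlier-terms) (ℕP.n∸n≡0 n) ⟩
    S + ℕ→ℚ (suc n) * ℓ (suc n) * 1ℚ
      ≡⟨ cong (λ x → S + ℕ→ℚ (suc n) * x * 1ℚ) (at-snoc (logList n) _ (length-SnocChain logList-chain n)) ⟩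
    S + ℕ→ℚ (suc n) * (F (suc n) - inv n * S) * 1ℚ
      ≡⟨ cong (_+_ S) (expand (ℕ→ℚ (suc n)) (F (suc n)) (inv n * S)) ⟩
    S + (ℕ→ℚ (suc n) * F (suc n) - ℕ→ℚ (suc n) * (inv n * S))
      ≡⟨ cong (λ x → S + (ℕ→ℚ (suc n) * F (suc n) - x)) ([1+n]*inv n S) ⟩
    S + (ℕ→ℚ (suc n) * F (suc n) - S)
      ≡⟨ cancel S (ℕ→ℚ (suc n) * F (suc n)) ⟩
    ℕ→ℚ (suc n) * F (suc n)
      ∎)
    where
    open ≡-Reasoning
    expand : ∀ c f x → c * (f - x) * 1ℚ ≡ c * f - c * x
    expand = solve-∀ ℚ-ring
    cancel : ∀ s x → s + (x - s) ≡ x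
    cancel = solve-∀ ℚ-ring
    term : ℕ → ℚ
    term j = θ ℓ j * F (suc n ∸ j)
    logTerm : ℕ → ℚ
    logTerm j = ℕ→ℚ j * at (logList n) j * fCoeff (suc n ∸ j)
    S = Σℚ< (suc n) logTerm
    earlier-terms : S ≡ ∑ (suc n) term
    earlier-terms = trans (Σℚ<≡∑ (suc n) logTerm) (∑-cong-< (suc n)
      (λ j j<1+n → cong (λ x → ℕ→ℚ j * x * F (suc n ∸ j)) (at-SnocChain logList-chain (ℕP.≤-pred j<1+n))))

expList-cong : ∀ n {L L′} → (∀ k → k ≤ n → L k ≡ L′ k) → expList L n ≡ expList L′ n
expList-cong zero    eq = refl
expList-cong (suc n) {L} {L′} eq with expList L n | expList-cong n {L} {L′} (λ k k≤n → eq k (ℕP.m≤n⇒m≤1+n k≤n))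
... | es | refl = cong (λ x → es List.++ List.[ inv n * x ]) (begin
  Σℚ< (suc (suc n)) (term L)   ≡⟨ Σℚ<≡∑ (suc (suc n)) (term L) ⟩
  ∑ (suc (suc n)) (term L)     ≡⟨ ∑-cong-< (suc (suc n)) (λ k k<2+n → cong (λ x → ℕ→ℚ k * x * at es (suc n ∸ k)) (eq k (ℕP.≤-pred k<2+n))) ⟩
  ∑ (suc (suc n)) (term L′)    ≡⟨ Σℚ<≡∑ (suc (suc n)) (term L′) ⟨
  Σℚ< (suc (suc n)) (term L′)  ∎)
  where
  open ≡-Reasoning
  term : (ℕ → ℚ) → ℕ → ℚ
  term L k = ℕ→ℚ k * L k * at es (suc n ∸ k)

T≡n!*expSeries : ∀ n s → T n s ≡ ℕ→ℚ (n !) * expSeries (λ k → ℓ k * s k) n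
T≡n!*expSeries n s = cong (λ xs → ℕ→ℚ (n !) * at xs n) (expList-cong n exponent-coefficients)
  where
  exponent-coefficients : ∀ k → k ≤ n → _ ≡ ℓ k * s k
  exponent-coefficients zero    _   = sym (ℚP.*-zeroˡ (s 0))
  exponent-coefficients (suc k) k≤n = cong (_* s (suc k)) (at-SnocChain logList-chain k≤n)

Fprod : ∀ {m} → Vec ℕ m → Series
Fprod []       = 𝟙
Fprod (d ∷ ds) = dilate d F ⊛ Fprod ds

F⁻¹ : Series
F⁻¹ = expSeries (⊖ ℓ)

F⊛F⁻¹ : F ⊛ F⁻¹ ≗ 𝟙
F⊛F⁻¹ = exp-inverse F-isExp (expSeries-isExp (⊖ ℓ))

Fquot : ∀ {m} → Vec ℕ m → Series
Fquot ds = Fprod ds ⊛ F⁻¹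

Fprod-isExp : ∀ {m} (ds : Vec ℕ m) → IsExp (λ k → ℓ k * σ ds k) (Fprod ds)
Fprod-isExp []       = IsExp-respˡ (λ k → sym (ℚP.*-zeroʳ (ℓ (suc k)))) exp-𝟘
Fprod-isExp (d ∷ ds) = IsExp-respˡ exponent (exp-⊕ (exp-dilate d F-isExp) (Fprod-isExp ds))
  where
  exponent : ∀ n → ℕ→ℚ (d ^ suc n) * ℓ (suc n) + ℓ (suc n) * σ ds (suc n) ≡ ℓ (suc n) * σ (d ∷ ds) (suc n)
  exponent n = trans (factor (ℕ→ℚ (d ^ suc n)) (ℓ (suc n)) (σ ds (suc n)))
                     (cong (ℓ (suc n) *_) (sym (ℕ→ℚ-homo-+ (d ^ suc n) _)))
    where
    factor : ∀ a l s → a * l + l * s ≡ l * (a + s)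
    factor = solve-∀ ℚ-ring

T-σ : ∀ {m} (ds : Vec ℕ m) n → T n (σ ds) ≡ ℕ→ℚ (n !) * Fprod ds n
T-σ ds n = trans (T≡n!*expSeries n (σ ds))
                 (cong (ℕ→ℚ (n !) *_) (exp-unique (expSeries-isExp _) (Fprod-isExp ds) n))

-- Since δ_k 2^k = σ_k − 1, the series with coefficients T_n(δ)/n! is Fquot at t/2.
T-δ : ∀ {m} (ds : Vec ℕ m) n → ℕ→ℚ (2 ^ n) * T n (δ ds) ≡ ℕ→ℚ (n !) * Fquot ds n
T-δ ds n = begin
  ℕ→ℚ (2 ^ n) * T n (δ ds)                ≡⟨ cong (ℕ→ℚ (2 ^ n) *_) (T≡n!*expSeries n (δ ds)) ⟩
  ℕ→ℚ (2 ^ n) * (ℕ→ℚ (n !) * Y n)         ≡⟨ swap (ℕ→ℚ (2 ^ n)) (ℕ→ℚ (n !)) (Y n) ⟩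
  ℕ→ℚ (n !) * dilate 2 Y n                ≡⟨ cong (ℕ→ℚ (n !) *_) (exp-unique dilated-isExp Fquot-isExp n) ⟩
  ℕ→ℚ (n !) * Fquot ds n                  ∎
  where
  open ≡-Reasoning
  swap : ∀ a b x → a * (b * x) ≡ b * (a * x)
  swap = solve-∀ ℚ-ring
  Y = expSeries (λ k → ℓ k * δ ds k)
  Fquot-isExp : IsExp ((λ k → ℓ k * σ ds k) ⊕ ⊖ ℓ) (Fquot ds)
  Fquot-isExp = exp-⊕ (Fprod-isExp ds) (expSeries-isExp (⊖ ℓ))
  dilated-isExp : IsExp ((λ k → ℓ k * σ ds k) ⊕ ⊖ ℓ) (dilate 2 Y)
  dilated-isExp = IsExp-respˡ exponent (exp-dilate 2 (expSeries-isExp _))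
    where
    undo-halving : ∀ c r l s → c * r ≡ 1ℚ → c * (l * ((s - 1ℚ) * r)) ≡ l * s + - l
    undo-halving c r l s cr≡1 = trans (regroup c r l s) (trans (cong (_* (l * s + - l)) cr≡1) (ℚP.*-identityˡ _))
      where
      regroup : ∀ c r l s → c * (l * ((s - 1ℚ) * r)) ≡ (c * r) * (l * s + - l)
      regroup = solve-∀ ℚ-ring
    exponent : ∀ n → dilate 2 (λ k → ℓ k * δ ds k) (suc n) ≡ ℓ (suc n) * σ ds (suc n) + - ℓ (suc n)
    exponent n = undo-halving (ℕ→ℚ (2 ^ suc n)) (1/ℕ (2 ^ suc n) {{ℕP.m^n≢0 2 (suc n)}}) (ℓ (suc n)) (σ ds (suc n))
                              (n*[1/n]≡1 (2 ^ suc n) {{ℕP.m^n≢0 2 (suc n)}})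

eᵗ : Series
eᵗ n = 1/ℕ (n !) {{n ℕP.!≢0}}

e^[_]t : ℕ → Series
e^[ d ]t = dilate d eᵗ

t : Series
t = shift 1 𝟙

eᵗ-isExp : IsExp t eᵗ
eᵗ-isExp = refl , λ n → trans (θeᵗ n) (sym (≗-trans (⊛-congˡ eᵗ θt) (≗-trans (shift-⊛ 1 𝟙 eᵗ) (shift-cong 1 (⊛-identityˡ eᵗ))) n))
  where
  θt : θ t ≗ t
  θt zero          = refl
  θt (suc zero)    = refl
  θt (suc (suc n)) = ℚP.*-zeroʳ (ℕ→ℚ (suc (suc n)))
  θeᵗ : θ eᵗ ≗ shift 1 eᵗ
  θeᵗ zero    = refl
  θeᵗ (suc n) = begin
    ℕ→ℚ (suc n) * 1/ℕ (suc n ℕ.* n !)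
      ≡⟨ cong (ℕ→ℚ (suc n) *_) (1/ℕ-homo-* (suc n) (n !)) ⟩
    ℕ→ℚ (suc n) * (1/ℕ (suc n) * eᵗ n)
      ≡⟨ ℚP.*-assoc (ℕ→ℚ (suc n)) _ _ ⟨
    ℕ→ℚ (suc n) * 1/ℕ (suc n) * eᵗ n
      ≡⟨ cong (_* eᵗ n) (n*[1/n]≡1 (suc n)) ⟩
    1ℚ * eᵗ n
      ≡⟨ ℚP.*-identityˡ (eᵗ n) ⟩
    eᵗ n ∎
    where
    open ≡-Reasoning
    instance
      n!≢0 : NonZero (n !)
      n!≢0 = n ℕP.!≢0
      [1+n]!≢0 : NonZero (suc n !)
      [1+n]!≢0 = suc n ℕP.!≢0

e^[]t-isExp : ∀ d → IsExp (ℕ→ℚ d • t) e^[ d ]t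
e^[]t-isExp d = IsExp-respˡ exponent (exp-dilate d eᵗ-isExp)
  where
  exponent : ∀ n → dilate d t (suc n) ≡ ℕ→ℚ d * t (suc n)
  exponent zero    = cong (λ x → ℕ→ℚ x * 1ℚ) (ℕP.*-identityʳ d)
  exponent (suc n) = trans (ℚP.*-zeroʳ (ℕ→ℚ (d ^ suc (suc n)))) (sym (ℚP.*-zeroʳ (ℕ→ℚ d)))

e^[]t-⊛ : ∀ a b → e^[ a ]t ⊛ e^[ b ]t ≗ e^[ a ℕ.+ b ]t
e^[]t-⊛ a b = exp-unique (exp-⊕ (e^[]t-isExp a) (e^[]t-isExp b)) (IsExp-respˡ exponent (e^[]t-isExp (a ℕ.+ b)))
  where
  exponent : ∀ n → ℕ→ℚ (a ℕ.+ b) * t (suc n) ≡ ℕ→ℚ a * t (suc n) + ℕ→ℚ b * t (suc n)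
  exponent n = trans (cong (_* t (suc n)) (ℕ→ℚ-homo-+ a b)) (ℚP.*-distribʳ-+ (t (suc n)) (ℕ→ℚ a) (ℕ→ℚ b))

e^[0]t : e^[ 0 ]t ≗ 𝟙
e^[0]t zero    = refl
e^[0]t (suc n) = ℚP.*-zeroˡ (eᵗ (suc n))

e^[]t-1 : ∀ d → e^[ d ]t ⊕ ⊖ 𝟙 ≗ shift 1 (ℕ→ℚ d • dilate d F)
e^[]t-1 d zero    = refl
e^[]t-1 d (suc n) = begin
  ℕ→ℚ (d ℕ.* d ^ n) * eᵗ (suc n) + - 0ℚ        ≡⟨ cong (λ x → x * eᵗ (suc n) + - 0ℚ) (ℕ→ℚ-homo-* d (d ^ n)) ⟩
  ℕ→ℚ d * ℕ→ℚ (d ^ n) * eᵗ (suc n) + - 0ℚ      ≡⟨ regroup (ℕ→ℚ d) (ℕ→ℚ (d ^ n)) (eᵗ (suc n)) ⟩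
  ℕ→ℚ d * (ℕ→ℚ (d ^ n) * eᵗ (suc n))           ∎
  where
  open ≡-Reasoning
  regroup : ∀ a b x → a * b * x + - 0ℚ ≡ a * (b * x)
  regroup = solve-∀ ℚ-ring

1-e^[]t : ∀ d → 𝟙 ⊕ ⊖ e^[ d ]t ≗ (- ℕ→ℚ d) • shift 1 (dilate d F)
1-e^[]t d n = begin
  𝟙 n + - e^[ d ]t n                               ≡⟨ negate (e^[ d ]t n) (𝟙 n) ⟩
  - (e^[ d ]t n + - 𝟙 n)                           ≡⟨ cong -_ (e^[]t-1 d n) ⟩
  - shift 1 (ℕ→ℚ d • dilate d F) n                 ≡⟨ cong -_ (shift-• 1 (ℕ→ℚ d) (dilate d F) n) ⟩
  - (ℕ→ℚ d * shift 1 (dilate d F) n)               ≡⟨ ℚP.neg-distribˡ-* (ℕ→ℚ d) _ ⟩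
  - ℕ→ℚ d * shift 1 (dilate d F) n                 ∎
  where
  open ≡-Reasoning
  negate : ∀ x y → y + - x ≡ - (x + - y)
  negate = solve-∀ ℚ-ring

geometric : ℕ → Series
geometric d n = ∑ d (λ k → e^[ k ]t n)

F⊛geometric : ∀ d → F ⊛ geometric d ≗ ℕ→ℚ d • dilate d F
F⊛geometric d n = begin
  (F ⊛ geometric d) n                                   ≡⟨ shift-⊛ 1 F (geometric d) (suc n) ⟨
  (shift 1 F ⊛ geometric d) (suc n)                     ≡⟨ ⊛-congˡ (geometric d) e^[1]t-1 (suc n) ⟨
  ((e^[ 1 ]t ⊕ ⊖ 𝟙) ⊛ geometric d) (suc n)              ≡⟨ ⊛-∑ d (e^[ 1 ]t ⊕ ⊖ 𝟙) e^[_]t (suc n) ⟩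
  ∑ d (λ k → ((e^[ 1 ]t ⊕ ⊖ 𝟙) ⊛ e^[ k ]t) (suc n))     ≡⟨ ∑-cong d step ⟩
  ∑ d (λ k → e^[ suc k ]t (suc n) - e^[ k ]t (suc n))   ≡⟨ ∑-telescope d (λ k → e^[ k ]t (suc n)) ⟩
  e^[ d ]t (suc n) - e^[ 0 ]t (suc n)                   ≡⟨ cong (λ x → e^[ d ]t (suc n) - x) (e^[0]t (suc n)) ⟩
  (e^[ d ]t ⊕ ⊖ 𝟙) (suc n)                              ≡⟨ e^[]t-1 d (suc n) ⟩
  ℕ→ℚ d * dilate d F n                                  ∎
  where
  open ≡-Reasoning
  e^[1]t-1 : e^[ 1 ]t ⊕ ⊖ 𝟙 ≗ shift 1 F
  e^[1]t-1 = ≗-trans (e^[]t-1 1) (shift-cong 1 (λ k → trans (ℚP.*-identityˡ _)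
                                                   (trans (cong (λ x → ℕ→ℚ x * F k) (ℕP.^-zeroˡ k)) (ℚP.*-identityˡ (F k)))))
  step : ∀ k → ((e^[ 1 ]t ⊕ ⊖ 𝟙) ⊛ e^[ k ]t) (suc n) ≡ e^[ suc k ]t (suc n) - e^[ k ]t (suc n)
  step k = trans (⊛-distribʳ-⊕ e^[ 1 ]t (⊖ 𝟙) e^[ k ]t (suc n))
                 (cong₂ _+_ (e^[]t-⊛ 1 k (suc n)) (trans (⊖-⊛ 𝟙 e^[ k ]t (suc n)) (cong -_ (⊛-identityˡ e^[ k ]t (suc n)))))

geometric≗F⁻¹⊛ : ∀ d → geometric d ≗ F⁻¹ ⊛ (ℕ→ℚ d • dilate d F)
geometric≗F⁻¹⊛ d = begin
  geometric d                        ≈⟨ ⊛-identityˡ (geometric d) ⟨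
  𝟙 ⊛ geometric d                    ≈⟨ ⊛-congˡ (geometric d) (≗-trans (⊛-comm F⁻¹ F) F⊛F⁻¹) ⟨
  (F⁻¹ ⊛ F) ⊛ geometric d            ≈⟨ ⊛-assoc F⁻¹ F (geometric d) ⟩
  F⁻¹ ⊛ (F ⊛ geometric d)            ≈⟨ ⊛-congʳ F⁻¹ (F⊛geometric d) ⟩
  F⁻¹ ⊛ (ℕ→ℚ d • dilate d F)         ∎
  where open ≗-Reasoning

signedπ : ∀ {m} → Vec ℕ m → ℚ
signedπ []       = 1ℚ
signedπ (d ∷ ds) = - ℕ→ℚ d * signedπ ds

∏[1-e^dt] : ∀ {m} → Vec ℕ m → Series
∏[1-e^dt] []       = 𝟙
∏[1-e^dt] (d ∷ ds) = (𝟙 ⊕ ⊖ e^[ d ]t) ⊛ ∏[1-e^dt] ds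

-- 1 − e^{dt} = −d t F(dt)
∏[1-e^dt]≗signedπ•shift : ∀ {m} (ds : Vec ℕ m) → ∏[1-e^dt] ds ≗ signedπ ds • shift m (Fprod ds)
∏[1-e^dt]≗signedπ•shift []               n = sym (ℚP.*-identityˡ (𝟙 n))
∏[1-e^dt]≗signedπ•shift {suc m} (d ∷ ds) = begin
  (𝟙 ⊕ ⊖ e^[ d ]t) ⊛ ∏[1-e^dt] ds
    ≈⟨ ⊛-cong (1-e^[]t d) (∏[1-e^dt]≗signedπ•shift ds) ⟩
  ((- ℕ→ℚ d) • shift 1 (dilate d F)) ⊛ (signedπ ds • shift m (Fprod ds))
    ≈⟨ •-⊛-assoc (- ℕ→ℚ d) (shift 1 (dilate d F)) _ ⟩
  (- ℕ→ℚ d) • (shift 1 (dilate d F) ⊛ (signedπ ds • shift m (Fprod ds)))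
    ≈⟨ •-cong (- ℕ→ℚ d) (≗-trans (⊛-•-comm (signedπ ds) (shift 1 (dilate d F)) _) (•-cong (signedπ ds) (shift-⊛-shift 1 m (dilate d F) (Fprod ds)))) ⟩
  (- ℕ→ℚ d) • (signedπ ds • shift (suc m) (Fprod (d ∷ ds)))
    ≈⟨ (λ n → ℚP.*-assoc (- ℕ→ℚ d) (signedπ ds) _) ⟨
  signedπ (d ∷ ds) • shift (suc m) (Fprod (d ∷ ds))
    ∎
  where open ≗-Reasoning

1-X^ : ℕ → Series
1-X^ d = 𝟙 ⊕ ⊖ shift d 𝟙

1-X^-⊛ : ∀ d A → 1-X^ d ⊛ A ≗ A ⊕ ⊖ shift d A
1-X^-⊛ d A n = trans (⊛-distribʳ-⊕ 𝟙 (⊖ shift d 𝟙) A n)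
  (cong₂ _+_ (⊛-identityˡ A n) (trans (⊖-⊛ (shift d 𝟙) A n) (cong -_ (trans (shift-⊛ d 𝟙 A n) (shift-cong d (⊛-identityˡ A) n)))))

shift-≤? : ∀ d A k → shift d A k ≡ (if does (d ℕ.≤? k) then A (k ∸ d) else 0ℚ)
shift-≤? zero          A k       = refl
shift-≤? (suc d)       A zero    = refl
shift-≤? (suc zero)    A (suc k) = refl
shift-≤? (suc (suc d)) A (suc k) = shift-≤? (suc d) A k

shift-< : ∀ d A {k} → k < d → shift d A k ≡ 0ℚ
shift-< (suc d) A {zero}  _         = refl
shift-< (suc d) A {suc k} (s≤s k<d) = shift-< d A k<d

prodSeries : ∀ {m} → Vec ℕ m → Series
prodSeries ds k = ℤ→ℚ (prodCoeff ds k)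

prodSeries-[] : prodSeries [] ≗ 𝟙
prodSeries-[] zero    = refl
prodSeries-[] (suc k) = refl

prodSeries-∷ : ∀ {m} d (ds : Vec ℕ m) → prodSeries (d ∷ ds) ≗ 1-X^ d ⊛ prodSeries ds
prodSeries-∷ d ds k = begin
  ℤ→ℚ (prodCoeff ds k ℤ.- lower)               ≡⟨ ℤ→ℚ-homo-+ (prodCoeff ds k) (ℤ.- lower) ⟩
  prodSeries ds k + ℤ→ℚ (ℤ.- lower)            ≡⟨ cong (_+_ (prodSeries ds k)) (trans (ℤ→ℚ-homo‿- lower) (cong -_ (ℤ→ℚ-if (does (d ℕ.≤? k))))) ⟩
  prodSeries ds k + - (if does (d ℕ.≤? k) then prodSeries ds (k ∸ d) else 0ℚ)
                                               ≡⟨ cong (λ x → prodSeries ds k + - x) (shift-≤? d (prodSeries ds) k) ⟨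
  (prodSeries ds ⊕ ⊖ shift d (prodSeries ds)) k ≡⟨ 1-X^-⊛ d (prodSeries ds) k ⟨
  (1-X^ d ⊛ prodSeries ds) k                   ∎
  where
  open ≡-Reasoning
  lower = if does (d ℕ.≤? k) then prodCoeff ds (k ∸ d) else + 0
  ℤ→ℚ-if : ∀ b → ℤ→ℚ (if b then prodCoeff ds (k ∸ d) else + 0) ≡ (if b then prodSeries ds (k ∸ d) else 0ℚ)
  ℤ→ℚ-if false = refl
  ℤ→ℚ-if true  = refl

hilbSeries : List ℕ → Series
hilbSeries gaps k = ℤ→ℚ (hilbCoeff gaps k)

QSeries : ∀ {m} → Vec ℕ m → List ℕ → Series
QSeries ds gaps k = ℤ→ℚ (QCoeff ds gaps k)

QSeries≗prod⊛hilb : ∀ {m} (ds : Vec ℕ m) gaps → QSeries ds gaps ≗ prodSeries ds ⊛ hilbSeries gaps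
QSeries≗prod⊛hilb ds gaps k = begin
  ℤ→ℚ (QCoeff ds gaps k)
    ≡⟨ ℤ→ℚ-Σℤ≤ k (λ j → hilbCoeff gaps (k ∸ j) ℤ.* prodCoeff ds j) ⟩
  ∑ (suc k) (λ j → ℤ→ℚ (hilbCoeff gaps (k ∸ j) ℤ.* prodCoeff ds j))
    ≡⟨ ∑-cong (suc k) (λ j → trans (ℤ→ℚ-homo-* (hilbCoeff gaps (k ∸ j)) (prodCoeff ds j)) (ℚP.*-comm (hilbSeries gaps (k ∸ j)) (prodSeries ds j))) ⟩
  ∑ (suc k) (λ j → prodSeries ds j * hilbSeries gaps (k ∸ j))
    ≡⟨ ⊛-≡-∑ (prodSeries ds) (hilbSeries gaps) k ⟨
  (prodSeries ds ⊛ hilbSeries gaps) k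
    ∎
  where open ≡-Reasoning

-- 1/(1 − X)
ones : Series
ones _ = 1ℚ

indicator : List ℕ → Series
indicator gaps k = if does (k ∈? gaps) then 1ℚ else 0ℚ

hilbSeries≗ones-indicator : ∀ gaps → hilbSeries gaps ≗ ones ⊕ ⊖ indicator gaps
hilbSeries≗ones-indicator gaps k = by-membership (does (k ∈? gaps))
  where
  by-membership : ∀ b → ℤ→ℚ (if b then + 0 else + 1) ≡ 1ℚ + - (if b then 1ℚ else 0ℚ)
  by-membership false = refl
  by-membership true  = refl

-- The factor 1 − X^{d₁} cancels the pole of 1/(1 − X).
QSeries-split : ∀ {m} d (ds : Vec ℕ m) gaps →
  QSeries (d ∷ ds) gaps ≗ prodSeries ds ⊛ (ones ⊕ ⊖ shift d ones) ⊕ ⊖ (prodSeries (d ∷ ds) ⊛ indicator gaps)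
QSeries-split d ds gaps = begin
  QSeries (d ∷ ds) gaps
    ≈⟨ QSeries≗prod⊛hilb (d ∷ ds) gaps ⟩
  prodSeries (d ∷ ds) ⊛ hilbSeries gaps
    ≈⟨ ⊛-congʳ (prodSeries (d ∷ ds)) (hilbSeries≗ones-indicator gaps) ⟩
  prodSeries (d ∷ ds) ⊛ (ones ⊕ ⊖ indicator gaps)
    ≈⟨ ⊛-distribˡ-⊕ (prodSeries (d ∷ ds)) ones (⊖ indicator gaps) ⟩
  prodSeries (d ∷ ds) ⊛ ones ⊕ prodSeries (d ∷ ds) ⊛ ⊖ indicator gaps
    ≈⟨ (λ n → cong₂ _+_ (geometric-part n) (⊛-⊖ (prodSeries (d ∷ ds)) (indicator gaps) n)) ⟩
  prodSeries ds ⊛ (ones ⊕ ⊖ shift d ones) ⊕ ⊖ (prodSeries (d ∷ ds) ⊛ indicator gaps)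
    ∎
  where
  open ≗-Reasoning
  geometric-part : prodSeries (d ∷ ds) ⊛ ones ≗ prodSeries ds ⊛ (ones ⊕ ⊖ shift d ones)
  geometric-part = begin
    prodSeries (d ∷ ds) ⊛ ones         ≈⟨ ⊛-congˡ ones (prodSeries-∷ d ds) ⟩
    (1-X^ d ⊛ prodSeries ds) ⊛ ones    ≈⟨ ⊛-assoc (1-X^ d) (prodSeries ds) ones ⟩
    1-X^ d ⊛ (prodSeries ds ⊛ ones)    ≈⟨ ⊛-swap (1-X^ d) (prodSeries ds) ones ⟩
    prodSeries ds ⊛ (1-X^ d ⊛ ones)    ≈⟨ ⊛-congʳ (prodSeries ds) (1-X^-⊛ d ones) ⟩
    prodSeries ds ⊛ (ones ⊕ ⊖ shift d ones) ∎

VanishesFrom : Series → ℕ → Set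
VanishesFrom A b = ∀ k → b ≤ k → A k ≡ 0ℚ

VanishesFrom-1-X^ : ∀ {A b} d → VanishesFrom A b → VanishesFrom (A ⊕ ⊖ shift d A) (d ℕ.+ b)
VanishesFrom-1-X^ {A} {b} d A≡0 k d+b≤k = begin
  A k + - shift d A k                        ≡⟨ cong₂ (λ x y → x + - y) (A≡0 k (ℕP.m+n≤o⇒n≤o d d+b≤k)) (cong (shift d A) k≡d+[k∸d]) ⟩
  0ℚ + - shift d A (d ℕ.+ (k ∸ d))           ≡⟨ cong (λ x → 0ℚ + - x) (trans (shift-+ d A (k ∸ d)) (A≡0 (k ∸ d) b≤k∸d)) ⟩
  0ℚ + - 0ℚ                                  ≡⟨⟩
  0ℚ                                         ∎
  where
  open ≡-Reasoning
  k≡d+[k∸d] : k ≡ d ℕ.+ (k ∸ d)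
  k≡d+[k∸d] = sym (ℕP.m+[n∸m]≡n (ℕP.m+n≤o⇒m≤o d d+b≤k))
  b≤k∸d : b ≤ k ∸ d
  b≤k∸d = ℕP.m+n≤o⇒m≤o∸n b (subst (_≤ k) (ℕP.+-comm d b) d+b≤k)

VanishesFrom-prod : ∀ {m} (ds : Vec ℕ m) {A b} → VanishesFrom A b → VanishesFrom (prodSeries ds ⊛ A) (Vec.sum ds ℕ.+ b)
VanishesFrom-prod []       {A} A≡0 k b≤k = trans (⊛-congˡ A prodSeries-[] k) (trans (⊛-identityˡ A k) (A≡0 k b≤k))
VanishesFrom-prod (d ∷ ds) {A} {b} A≡0 k bound≤k = begin
  (prodSeries (d ∷ ds) ⊛ A) k                       ≡⟨ trans (⊛-congˡ A (prodSeries-∷ d ds) k) (⊛-assoc (1-X^ d) (prodSeries ds) A k) ⟩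
  (1-X^ d ⊛ (prodSeries ds ⊛ A)) k                  ≡⟨ 1-X^-⊛ d (prodSeries ds ⊛ A) k ⟩
  (P ⊕ ⊖ shift d P) k                               ≡⟨ VanishesFrom-1-X^ d (VanishesFrom-prod ds A≡0) k (subst (_≤ k) (ℕP.+-assoc d _ b) bound≤k) ⟩
  0ℚ                                                ∎
  where
  open ≡-Reasoning
  P = prodSeries ds ⊛ A

-- A(e^t), for A vanishing from B on
evalAtExp : ℕ → Series → Series
evalAtExp B A n = ∑ B (λ k → A k * e^[ k ]t n)

evalAtExp-cong : ∀ B {A A′} → A ≗ A′ → evalAtExp B A ≗ evalAtExp B A′
evalAtExp-cong B eq n = ∑-cong B (λ k → cong (_* e^[ k ]t n) (eq k))

evalAtExp-⊕ : ∀ B A A′ → evalAtExp B (A ⊕ A′) ≗ evalAtExp B A ⊕ evalAtExp B A′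
evalAtExp-⊕ B A A′ n = trans (∑-cong B (λ k → ℚP.*-distribʳ-+ (e^[ k ]t n) (A k) (A′ k))) (∑-distrib-+ B _ _)

evalAtExp-⊖ : ∀ B A → evalAtExp B (⊖ A) ≗ ⊖ evalAtExp B A
evalAtExp-⊖ B A n = trans (∑-cong B (λ k → sym (ℚP.neg-distribˡ-* (A k) (e^[ k ]t n)))) (∑-neg B _)

evalAtExp-truncate : ∀ {A b} B B′ → VanishesFrom A b → b ≤ B → b ≤ B′ → evalAtExp B A ≗ evalAtExp B′ A
evalAtExp-truncate {A} {b} B B′ A≡0 b≤B b≤B′ n = trans (∑-truncate b B _ b≤B terms≡0) (sym (∑-truncate b B′ _ b≤B′ terms≡0))
  where
  terms≡0 : ∀ k → b ≤ k → A k * e^[ k ]t n ≡ 0ℚ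
  terms≡0 k b≤k = trans (cong (_* e^[ k ]t n) (A≡0 k b≤k)) (ℚP.*-zeroˡ (e^[ k ]t n))

evalAtExp-shift : ∀ {A b} B d → VanishesFrom A b → d ℕ.+ b ≤ B → evalAtExp B (shift d A) ≗ e^[ d ]t ⊛ evalAtExp B A
evalAtExp-shift {A} {b} B d A≡0 d+b≤B n = begin
  ∑ B term
    ≡⟨ cong (λ k → ∑ k term) (ℕP.m+[n∸m]≡n d≤B) ⟨
  ∑ (d ℕ.+ (B ∸ d)) term
    ≡⟨ ∑-+ d (B ∸ d) term ⟩
  ∑ d term + ∑ (B ∸ d) (λ i → term (d ℕ.+ i))
    ≡⟨ cong₂ _+_ (∑-zero d term (λ k k<d → trans (cong (_* e^[ k ]t n) (shift-< d A k<d)) (ℚP.*-zeroˡ (e^[ k ]t n)))) (∑-cong (B ∸ d) shifted-term) ⟩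
  0ℚ + ∑ (B ∸ d) (λ i → (e^[ d ]t ⊛ (A i • e^[ i ]t)) n)
    ≡⟨ ℚP.+-identityˡ _ ⟩
  ∑ (B ∸ d) (λ i → (e^[ d ]t ⊛ (A i • e^[ i ]t)) n)
    ≡⟨ ⊛-∑ (B ∸ d) e^[ d ]t (λ i → A i • e^[ i ]t) n ⟨
  (e^[ d ]t ⊛ evalAtExp (B ∸ d) A) n
    ≡⟨ ⊛-congʳ e^[ d ]t (evalAtExp-truncate (B ∸ d) B A≡0 b≤B∸d (ℕP.m+n≤o⇒n≤o d d+b≤B)) n ⟩
  (e^[ d ]t ⊛ evalAtExp B A) n
    ∎
  where
  open ≡-Reasoning
  term : ℕ → ℚ
  term k = shift d A k * e^[ k ]t n
  d≤B : d ≤ B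
  d≤B = ℕP.m+n≤o⇒m≤o d d+b≤B
  b≤B∸d : b ≤ B ∸ d
  b≤B∸d = ℕP.m+n≤o⇒m≤o∸n b (subst (_≤ B) (ℕP.+-comm d b) d+b≤B)
  shifted-term : ∀ i → term (d ℕ.+ i) ≡ (e^[ d ]t ⊛ (A i • e^[ i ]t)) n
  shifted-term i = trans (cong₂ _*_ (shift-+ d A i) (sym (e^[]t-⊛ d i n))) (sym (⊛-•-comm (A i) e^[ d ]t e^[ i ]t n))

evalAtExp-1-X^ : ∀ {A b} B d → VanishesFrom A b → d ℕ.+ b ≤ B →
  evalAtExp B (1-X^ d ⊛ A) ≗ (𝟙 ⊕ ⊖ e^[ d ]t) ⊛ evalAtExp B A
evalAtExp-1-X^ {A} B d A≡0 d+b≤B = begin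
  evalAtExp B (1-X^ d ⊛ A)                              ≈⟨ evalAtExp-cong B (1-X^-⊛ d A) ⟩
  evalAtExp B (A ⊕ ⊖ shift d A)                         ≈⟨ evalAtExp-⊕ B A (⊖ shift d A) ⟩
  evalAtExp B A ⊕ evalAtExp B (⊖ shift d A)             ≈⟨ (λ n → cong (_+_ (evalAtExp B A n)) (trans (evalAtExp-⊖ B (shift d A) n) (cong -_ (evalAtExp-shift B d A≡0 d+b≤B n)))) ⟩
  evalAtExp B A ⊕ ⊖ (e^[ d ]t ⊛ evalAtExp B A)          ≈⟨ ≗-sym (1-e-⊛ (evalAtExp B A)) ⟩
  (𝟙 ⊕ ⊖ e^[ d ]t) ⊛ evalAtExp B A                      ∎
  where
  open ≗-Reasoning
  1-e-⊛ : ∀ X → (𝟙 ⊕ ⊖ e^[ d ]t) ⊛ X ≗ X ⊕ ⊖ (e^[ d ]t ⊛ X)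
  1-e-⊛ X n = trans (⊛-distribʳ-⊕ 𝟙 (⊖ e^[ d ]t) X n) (cong₂ _+_ (⊛-identityˡ X n) (⊖-⊛ e^[ d ]t X n))

evalAtExp-prod : ∀ {m} (ds : Vec ℕ m) {A b} B → VanishesFrom A b → Vec.sum ds ℕ.+ b ≤ B →
  evalAtExp B (prodSeries ds ⊛ A) ≗ ∏[1-e^dt] ds ⊛ evalAtExp B A
evalAtExp-prod [] {A} B A≡0 b≤B =
  ≗-trans (evalAtExp-cong B (≗-trans (⊛-congˡ A prodSeries-[]) (⊛-identityˡ A))) (≗-sym (⊛-identityˡ (evalAtExp B A)))
evalAtExp-prod (d ∷ ds) {A} {b} B A≡0 bound≤B = begin
  evalAtExp B (prodSeries (d ∷ ds) ⊛ A)
    ≈⟨ evalAtExp-cong B (≗-trans (⊛-congˡ A (prodSeries-∷ d ds)) (⊛-assoc (1-X^ d) (prodSeries ds) A)) ⟩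
  evalAtExp B (1-X^ d ⊛ (prodSeries ds ⊛ A))
    ≈⟨ evalAtExp-1-X^ B d (VanishesFrom-prod ds A≡0) bound≤B′ ⟩
  (𝟙 ⊕ ⊖ e^[ d ]t) ⊛ evalAtExp B (prodSeries ds ⊛ A)
    ≈⟨ ⊛-congʳ (𝟙 ⊕ ⊖ e^[ d ]t) (evalAtExp-prod ds B A≡0 (ℕP.m+n≤o⇒n≤o d bound≤B′)) ⟩
  (𝟙 ⊕ ⊖ e^[ d ]t) ⊛ (∏[1-e^dt] ds ⊛ evalAtExp B A)
    ≈⟨ ⊛-assoc (𝟙 ⊕ ⊖ e^[ d ]t) (∏[1-e^dt] ds) (evalAtExp B A) ⟨
  ∏[1-e^dt] (d ∷ ds) ⊛ evalAtExp B A
    ∎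
  where
  open ≗-Reasoning
  bound≤B′ : d ℕ.+ (Vec.sum ds ℕ.+ b) ≤ B
  bound≤B′ = subst (_≤ B) (ℕP.+-assoc d (Vec.sum ds) b) bound≤B

VanishesFrom-geometric : ∀ d → VanishesFrom (ones ⊕ ⊖ shift d ones) d
VanishesFrom-geometric d k d≤k = begin
  1ℚ + - shift d ones k                  ≡⟨ cong (λ j → 1ℚ + - shift d ones j) (ℕP.m+[n∸m]≡n d≤k) ⟨
  1ℚ + - shift d ones (d ℕ.+ (k ∸ d))    ≡⟨ cong (λ x → 1ℚ + - x) (shift-+ d ones (k ∸ d)) ⟩
  1ℚ + - 1ℚ                              ≡⟨⟩
  0ℚ                                     ∎
  where open ≡-Reasoning

evalAtExp-geometric : ∀ B d → d ≤ B → evalAtExp B (ones ⊕ ⊖ shift d ones) ≗ geometric d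
evalAtExp-geometric B d d≤B n = trans (∑-truncate d B _ d≤B terms≡0) (∑-cong-< d low-terms)
  where
  terms≡0 : ∀ k → d ≤ k → (1ℚ + - shift d ones k) * e^[ k ]t n ≡ 0ℚ
  terms≡0 k d≤k = trans (cong (_* e^[ k ]t n) (VanishesFrom-geometric d k d≤k)) (ℚP.*-zeroˡ (e^[ k ]t n))
  low-terms : ∀ k → k < d → (1ℚ + - shift d ones k) * e^[ k ]t n ≡ e^[ k ]t n
  low-terms k k<d = trans (cong (λ x → (1ℚ + - x) * e^[ k ]t n) (shift-< d ones k<d)) (ℚP.*-identityˡ _)

indicator-∉ : ∀ {k} gaps → ¬ k ∈ gaps → indicator gaps k ≡ 0ℚ
indicator-∉ {k} gaps k∉gaps with k ∈? gaps
... | yes k∈gaps = ⊥-elim (k∉gaps k∈gaps)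
... | no _       = refl

indicator-∷ : ∀ g gs → ¬ g ∈ gs → indicator (g ∷ gs) ≗ (λ k → if does (k ℕ.≟ g) then 1ℚ else 0ℚ) ⊕ indicator gs
indicator-∷ g gs g∉gs k = by-cases (k ℕ.≟ g) (k ∈? gs)
  where
  [_] : Bool → ℚ
  [ b ] = if b then 1ℚ else 0ℚ
  by-cases : (k≟g : Dec (k ≡ g)) (k∈?gs : Dec (k ∈ gs)) → [ does k≟g ∨ does k∈?gs ] ≡ [ does k≟g ] + [ does k∈?gs ]
  by-cases (yes refl) (yes g∈gs) = ⊥-elim (g∉gs g∈gs)
  by-cases (yes _)    (no _)     = refl
  by-cases (no _)     (yes _)    = refl
  by-cases (no _)     (no _)     = refl

gapSeries : List ℕ → Series
gapSeries gaps n = List.foldr _+_ 0ℚ (List.map (λ g → e^[ g ]t n) gaps)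

G≡r!*gapSeries : ∀ gaps r → G gaps r ≡ ℕ→ℚ (r !) * gapSeries gaps r
G≡r!*gapSeries []       r = sym (ℚP.*-zeroʳ (ℕ→ℚ (r !)))
G≡r!*gapSeries (g ∷ gs) r = begin
  ℕ→ℚ (g ^ r) + G gs r                                       ≡⟨ cong₂ _+_ (sym (cancel-r! (ℕ→ℚ (g ^ r)))) (G≡r!*gapSeries gs r) ⟩
  ℕ→ℚ (r !) * e^[ g ]t r + ℕ→ℚ (r !) * gapSeries gs r        ≡⟨ ℚP.*-distribˡ-+ (ℕ→ℚ (r !)) _ _ ⟨
  ℕ→ℚ (r !) * (e^[ g ]t r + gapSeries gs r)                  ∎
  where
  open ≡-Reasoning
  cancel-r! : ∀ x → ℕ→ℚ (r !) * (x * eᵗ r) ≡ x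
  cancel-r! x = trans (swap (ℕ→ℚ (r !)) x (eᵗ r)) (trans (cong (x *_) (n*[1/n]≡1 (r !) {{r ℕP.!≢0}})) (ℚP.*-identityʳ x))
    where
    swap : ∀ a x y → a * (x * y) ≡ x * (a * y)
    swap = solve-∀ ℚ-ring

evalAtExp-indicator : ∀ B gaps → Unique gaps → (∀ g → g ∈ gaps → g < B) → evalAtExp B (indicator gaps) ≗ gapSeries gaps
evalAtExp-indicator B []       _                  _   n = ∑-zero B _ (λ k _ → ℚP.*-zeroˡ (e^[ k ]t n))
evalAtExp-indicator B (g ∷ gs) (g≢gs ∷ unique-gs) <B  n = begin
  evalAtExp B (indicator (g ∷ gs)) n
    ≡⟨ evalAtExp-cong B (indicator-∷ g gs (All¬⇒¬Any g≢gs)) n ⟩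
  evalAtExp B (Xᵍ ⊕ indicator gs) n
    ≡⟨ evalAtExp-⊕ B Xᵍ (indicator gs) n ⟩
  evalAtExp B Xᵍ n + evalAtExp B (indicator gs) n
    ≡⟨ cong₂ _+_ (trans (∑-single B g _ (<B g (here refl)) other-terms) (only-term (g ℕ.≟ g))) (evalAtExp-indicator B gs unique-gs (λ g′ → <B g′ ∘ there) n) ⟩
  e^[ g ]t n + gapSeries gs n
    ∎
  where
  open ≡-Reasoning
  Xᵍ : Series
  Xᵍ k = if does (k ℕ.≟ g) then 1ℚ else 0ℚ
  other-terms : ∀ k → k ≢ g → Xᵍ k * e^[ k ]t n ≡ 0ℚ
  other-terms k k≢g = by-cases (k ℕ.≟ g)
    where
    by-cases : (k≟g : Dec (k ≡ g)) → (if does k≟g then 1ℚ else 0ℚ) * e^[ k ]t n ≡ 0ℚ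
    by-cases (yes k≡g) = ⊥-elim (k≢g k≡g)
    by-cases (no _)    = ℚP.*-zeroˡ (e^[ k ]t n)
  only-term : (g≟g : Dec (g ≡ g)) → (if does g≟g then 1ℚ else 0ℚ) * e^[ g ]t n ≡ e^[ g ]t n
  only-term (yes _)   = ℚP.*-identityˡ (e^[ g ]t n)
  only-term (no g≢g)  = ⊥-elim (g≢g refl)

gapBound : List ℕ → ℕ
gapBound gaps = sum (List.map suc gaps)

∈⇒<gapBound : ∀ {g} gaps → g ∈ gaps → g < gapBound gaps
∈⇒<gapBound (g ∷ gs) (here refl) = ℕP.m≤m+n (suc g) (gapBound gs)
∈⇒<gapBound (g ∷ gs) (there g∈gs) = ℕP.m≤n⇒m≤o+n (suc g) (∈⇒<gapBound gs g∈gs)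

VanishesFrom-indicator : ∀ gaps → VanishesFrom (indicator gaps) (gapBound gaps)
VanishesFrom-indicator gaps k bound≤k = indicator-∉ gaps (λ k∈gaps → ℕP.<⇒≱ (∈⇒<gapBound gaps k∈gaps) bound≤k)

evalAtExp-Q : ∀ {m} d (ds : Vec ℕ m) gaps → Unique gaps → ∀ B → Vec.sum (d ∷ ds) ℕ.+ gapBound gaps ≤ B →
  evalAtExp B (QSeries (d ∷ ds) gaps) ≗ ∏[1-e^dt] ds ⊛ geometric d ⊕ ⊖ (∏[1-e^dt] (d ∷ ds) ⊛ gapSeries gaps)
evalAtExp-Q d ds gaps unique B bound≤B = begin
  evalAtExp B (QSeries (d ∷ ds) gaps)
    ≈⟨ evalAtExp-cong B (QSeries-split d ds gaps) ⟩
  evalAtExp B (geometric-part ⊕ ⊖ gap-part)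
    ≈⟨ ≗-trans (evalAtExp-⊕ B geometric-part (⊖ gap-part)) (λ n → cong (_+_ (evalAtExp B geometric-part n)) (evalAtExp-⊖ B gap-part n)) ⟩
  evalAtExp B geometric-part ⊕ ⊖ evalAtExp B gap-part
    ≈⟨ (λ n → cong₂ (λ x y → x + - y)
         (evalAtExp-prod ds B (VanishesFrom-geometric d) (subst (_≤ B) (ℕP.+-comm d _) sum≤B) n)
         (evalAtExp-prod (d ∷ ds) B (VanishesFrom-indicator gaps) bound≤B n)) ⟩
  ∏[1-e^dt] ds ⊛ evalAtExp B (ones ⊕ ⊖ shift d ones) ⊕ ⊖ (∏[1-e^dt] (d ∷ ds) ⊛ evalAtExp B (indicator gaps))
    ≈⟨ (λ n → cong₂ (λ x y → x + - y)
         (⊛-congʳ (∏[1-e^dt] ds) (evalAtExp-geometric B d (ℕP.m+n≤o⇒m≤o d sum≤B)) n)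
         (⊛-congʳ (∏[1-e^dt] (d ∷ ds)) (evalAtExp-indicator B gaps unique gap<B) n)) ⟩
  ∏[1-e^dt] ds ⊛ geometric d ⊕ ⊖ (∏[1-e^dt] (d ∷ ds) ⊛ gapSeries gaps)
    ∎
  where
  open ≗-Reasoning
  geometric-part = prodSeries ds ⊛ (ones ⊕ ⊖ shift d ones)
  gap-part = prodSeries (d ∷ ds) ⊛ indicator gaps
  sum≤B : Vec.sum (d ∷ ds) ≤ B
  sum≤B = ℕP.m+n≤o⇒m≤o _ bound≤B
  gap<B : ∀ g → g ∈ gaps → g < B
  gap<B g g∈gaps = ℕP.≤-trans (∈⇒<gapBound gaps g∈gaps) (ℕP.m+n≤o⇒n≤o _ bound≤B)

∏[1-e^dt]-⊛ : ∀ {m} (ds : Vec ℕ m) A → ∏[1-e^dt] ds ⊛ A ≗ signedπ ds • shift m (Fprod ds ⊛ A)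
∏[1-e^dt]-⊛ {m} ds A = begin
  ∏[1-e^dt] ds ⊛ A                          ≈⟨ ⊛-congˡ A (∏[1-e^dt]≗signedπ•shift ds) ⟩
  (signedπ ds • shift m (Fprod ds)) ⊛ A     ≈⟨ •-⊛-assoc (signedπ ds) (shift m (Fprod ds)) A ⟩
  signedπ ds • (shift m (Fprod ds) ⊛ A)     ≈⟨ •-cong (signedπ ds) (shift-⊛ m (Fprod ds) A) ⟩
  signedπ ds • shift m (Fprod ds ⊛ A)       ∎
  where open ≗-Reasoning

Fprod⊛geometric : ∀ {m} d (ds : Vec ℕ m) → Fprod ds ⊛ geometric d ≗ ℕ→ℚ d • Fquot (d ∷ ds)
Fprod⊛geometric d ds = begin
  Fprod ds ⊛ geometric d                          ≈⟨ ⊛-congʳ (Fprod ds) (geometric≗F⁻¹⊛ d) ⟩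
  Fprod ds ⊛ (F⁻¹ ⊛ (ℕ→ℚ d • dilate d F))         ≈⟨ ⊛-congʳ (Fprod ds) (⊛-•-comm (ℕ→ℚ d) F⁻¹ (dilate d F)) ⟩
  Fprod ds ⊛ (ℕ→ℚ d • (F⁻¹ ⊛ dilate d F))         ≈⟨ ⊛-•-comm (ℕ→ℚ d) (Fprod ds) (F⁻¹ ⊛ dilate d F) ⟩
  ℕ→ℚ d • (Fprod ds ⊛ (F⁻¹ ⊛ dilate d F))         ≈⟨ •-cong (ℕ→ℚ d) rearrange ⟩
  ℕ→ℚ d • Fquot (d ∷ ds)                          ∎
  where
  open ≗-Reasoning
  rearrange : Fprod ds ⊛ (F⁻¹ ⊛ dilate d F) ≗ (dilate d F ⊛ Fprod ds) ⊛ F⁻¹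
  rearrange = begin
    Fprod ds ⊛ (F⁻¹ ⊛ dilate d F)     ≈⟨ ⊛-congʳ (Fprod ds) (⊛-comm F⁻¹ (dilate d F)) ⟩
    Fprod ds ⊛ (dilate d F ⊛ F⁻¹)     ≈⟨ ⊛-assoc (Fprod ds) (dilate d F) F⁻¹ ⟨
    (Fprod ds ⊛ dilate d F) ⊛ F⁻¹     ≈⟨ ⊛-congˡ F⁻¹ (⊛-comm (Fprod ds) (dilate d F)) ⟩
    (dilate d F ⊛ Fprod ds) ⊛ F⁻¹     ∎

Q-at-exp : ∀ {m} d (ds : Vec ℕ m) gaps → Unique gaps → ∀ B → Vec.sum (d ∷ ds) ℕ.+ gapBound gaps ≤ B →
  evalAtExp B (QSeries (d ∷ ds) gaps)
    ≗ (- signedπ (d ∷ ds)) • (shift m (Fquot (d ∷ ds)) ⊕ shift (suc m) (Fprod (d ∷ ds) ⊛ gapSeries gaps))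
Q-at-exp {m} d ds gaps unique B bound≤B = begin
  evalAtExp B (QSeries (d ∷ ds) gaps)
    ≈⟨ evalAtExp-Q d ds gaps unique B bound≤B ⟩
  ∏[1-e^dt] ds ⊛ geometric d ⊕ ⊖ (∏[1-e^dt] (d ∷ ds) ⊛ gapSeries gaps)
    ≈⟨ (λ n → cong₂ (λ x y → x + - y)
         (trans (∏[1-e^dt]-⊛ ds (geometric d) n) (cong (signedπ ds *_) (trans (shift-cong m (Fprod⊛geometric d ds) n) (shift-• m (ℕ→ℚ d) _ n))))
         (∏[1-e^dt]-⊛ (d ∷ ds) (gapSeries gaps) n)) ⟩
  (λ n → signedπ ds * (ℕ→ℚ d * W n) + - (signedπ (d ∷ ds) * Y n))
    ≈⟨ (λ n → regroup (signedπ ds) (ℕ→ℚ d) (W n) (Y n)) ⟩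
  (- signedπ (d ∷ ds)) • (W ⊕ Y)
    ∎
  where
  open ≗-Reasoning
  W = shift m (Fquot (d ∷ ds))
  Y = shift (suc m) (Fprod (d ∷ ds) ⊛ gapSeries gaps)
  regroup : ∀ s d w y → s * (d * w) + - (- d * s * y) ≡ - (- d * s) * (w + y)
  regroup = solve-∀ ℚ-ring

n!*evalAtExp : ∀ {A b} B n → VanishesFrom A b → b ≤ B → ℕ→ℚ (n !) * evalAtExp B A n ≡ ∑ b (λ k → ℕ→ℚ (k ^ n) * A k)
n!*evalAtExp {A} {b} B n A≡0 b≤B = begin
  ℕ→ℚ (n !) * ∑ B (λ k → A k * (ℕ→ℚ (k ^ n) * eᵗ n))       ≡⟨ cong (ℕ→ℚ (n !) *_) (evalAtExp-truncate B b A≡0 b≤B ℕP.≤-refl n) ⟩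
  ℕ→ℚ (n !) * ∑ b (λ k → A k * (ℕ→ℚ (k ^ n) * eᵗ n))       ≡⟨ cong (ℕ→ℚ (n !) *_) (∑-cong b (λ k → regroup (A k) (ℕ→ℚ (k ^ n)) (eᵗ n))) ⟩
  ℕ→ℚ (n !) * ∑ b (λ k → ℕ→ℚ (k ^ n) * A k * eᵗ n)         ≡⟨ cong (ℕ→ℚ (n !) *_) (∑-*ʳ b (eᵗ n) _) ⟩
  ℕ→ℚ (n !) * (∑ b (λ k → ℕ→ℚ (k ^ n) * A k) * eᵗ n)       ≡⟨ cancel (ℕ→ℚ (n !)) _ (eᵗ n) (n*[1/n]≡1 (n !) {{n ℕP.!≢0}}) ⟩
  ∑ b (λ k → ℕ→ℚ (k ^ n) * A k)                            ∎
  where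
  open ≡-Reasoning
  regroup : ∀ a p e → a * (p * e) ≡ p * a * e
  regroup = solve-∀ ℚ-ring
  cancel : ∀ c x r → c * r ≡ 1ℚ → c * (x * r) ≡ x
  cancel c x r cr≡1 = trans (swap c x r) (trans (cong (x *_) cr≡1) (ℚP.*-identityʳ x))
    where
    swap : ∀ a x y → a * (x * y) ≡ x * (a * y)
    swap = solve-∀ ℚ-ring

-- The c₀ term drops out since 0^{n+1} = 0; the other c_k are −Q_k.
𝒞≡-power-sum : ∀ {m} (ds : Vec ℕ m) gaps N n →
  ℤ→ℚ (𝒞 ds gaps N (suc n)) ≡ - ∑ (suc N) (λ k → ℕ→ℚ (k ^ suc n) * QSeries ds gaps k)
𝒞≡-power-sum ds gaps N n = begin
  ℤ→ℚ (𝒞 ds gaps N (suc n))                                    ≡⟨ ℤ→ℚ-Σℤ≤ N (λ k → + (k ^ suc n) ℤ.* cCoeff ds gaps k) ⟩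
  ∑ (suc N) (λ k → ℤ→ℚ (+ (k ^ suc n) ℤ.* cCoeff ds gaps k))   ≡⟨ ∑-cong (suc N) term ⟩
  ∑ (suc N) (λ k → - (ℕ→ℚ (k ^ suc n) * QSeries ds gaps k))    ≡⟨ ∑-neg (suc N) (λ k → ℕ→ℚ (k ^ suc n) * QSeries ds gaps k) ⟩
  - ∑ (suc N) (λ k → ℕ→ℚ (k ^ suc n) * QSeries ds gaps k)      ∎
  where
  open ≡-Reasoning
  term : ∀ k → ℤ→ℚ (+ (k ^ suc n) ℤ.* cCoeff ds gaps k) ≡ - (ℕ→ℚ (k ^ suc n) * QSeries ds gaps k)
  term zero    = trans (ℤ→ℚ-homo-* (+ 0) (cCoeff ds gaps 0)) (zero-terms (ℤ→ℚ (cCoeff ds gaps 0)) (QSeries ds gaps 0))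
    where
    zero-terms : ∀ x y → 0ℚ * x ≡ - (0ℚ * y)
    zero-terms = solve-∀ ℚ-ring
  term (suc k) = trans (ℤ→ℚ-homo-* (+ (suc k ^ suc n)) _)
                       (trans (cong (ℕ→ℚ (suc k ^ suc n) *_) (ℤ→ℚ-homo‿- (QCoeff ds gaps (suc k))))
                              (sym (ℚP.neg-distribʳ-* (ℕ→ℚ (suc k ^ suc n)) _)))

sign : ℕ → ℚ
sign m = ℤ→ℚ ((ℤ.- + 1) ℤ.^ m)

sign-suc : ∀ m → sign (suc m) ≡ - 1ℚ * sign m
sign-suc m = trans (ℤ→ℚ-homo-* (ℤ.- + 1) ((ℤ.- + 1) ℤ.^ m)) (cong (_* sign m) (ℤ→ℚ-homo‿- (+ 1)))

sign*sign : ∀ m → sign m * sign m ≡ 1ℚ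
sign*sign zero    = refl
sign*sign (suc m) = trans (cong₂ _*_ (sign-suc m) (sign-suc m)) (trans (square (sign m)) (sign*sign m))
  where
  square : ∀ x → - 1ℚ * x * (- 1ℚ * x) ≡ x * x
  square = solve-∀ ℚ-ring

signedπ≡sign*πm : ∀ {m} (ds : Vec ℕ m) → signedπ ds ≡ sign m * ℕ→ℚ (πm ds)
signedπ≡sign*πm []               = refl
signedπ≡sign*πm {suc m} (d ∷ ds) = begin
  - ℕ→ℚ d * signedπ ds                     ≡⟨ cong (- ℕ→ℚ d *_) (signedπ≡sign*πm ds) ⟩
  - ℕ→ℚ d * (sign m * ℕ→ℚ (πm ds))         ≡⟨ regroup (ℕ→ℚ d) (sign m) (ℕ→ℚ (πm ds)) ⟩
  (- 1ℚ * sign m) * (ℕ→ℚ d * ℕ→ℚ (πm ds))  ≡⟨ cong₂ _*_ (sign-suc m) (ℕ→ℚ-homo-* d (πm ds)) ⟨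
  sign (suc m) * ℕ→ℚ (πm (d ∷ ds))         ∎
  where
  open ≡-Reasoning
  regroup : ∀ d s p → - d * (s * p) ≡ (- 1ℚ * s) * (d * p)
  regroup = solve-∀ ℚ-ring

𝒞≡n!*signedπ*coefficients : ∀ {m} d (ds : Vec ℕ m) gaps → Unique gaps →
  ∀ N → (∀ k → N < k → QCoeff (d ∷ ds) gaps k ≡ + 0) → ∀ p →
  ℤ→ℚ (𝒞 (d ∷ ds) gaps N (suc (m ℕ.+ p)))
    ≡ ℕ→ℚ (suc (m ℕ.+ p) !) * (signedπ (d ∷ ds) * (Fquot (d ∷ ds) (suc p) + (Fprod (d ∷ ds) ⊛ gapSeries gaps) p))
𝒞≡n!*signedπ*coefficients {m} d ds gaps unique N Q≡0 p = begin
  ℤ→ℚ (𝒞 (d ∷ ds) gaps N n)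
    ≡⟨ 𝒞≡-power-sum (d ∷ ds) gaps N (m ℕ.+ p) ⟩
  - ∑ (suc N) (λ k → ℕ→ℚ (k ^ n) * QSeries (d ∷ ds) gaps k)
    ≡⟨ cong -_ (n!*evalAtExp B n (λ k N<k → cong ℤ→ℚ (Q≡0 k N<k)) (ℕP.m≤m+n (suc N) _)) ⟨
  - (ℕ→ℚ (n !) * evalAtExp B (QSeries (d ∷ ds) gaps) n)
    ≡⟨ cong (λ x → - (ℕ→ℚ (n !) * x)) (Q-at-exp d ds gaps unique B (ℕP.m≤n+m _ (suc N)) n) ⟩
  - (ℕ→ℚ (n !) * (- signedπ (d ∷ ds) * (shift m W ⊕ shift (suc m) Y) n))
    ≡⟨ negate-twice (ℕ→ℚ (n !)) (signedπ (d ∷ ds)) _ ⟩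
  ℕ→ℚ (n !) * (signedπ (d ∷ ds) * (shift m W ⊕ shift (suc m) Y) n)
    ≡⟨ cong (λ x → ℕ→ℚ (n !) * (signedπ (d ∷ ds) * x)) shifted-coefficient ⟩
  ℕ→ℚ (n !) * (signedπ (d ∷ ds) * (W (suc p) + Y p))
    ∎
  where
  open ≡-Reasoning
  n = suc (m ℕ.+ p)
  B = suc N ℕ.+ (Vec.sum (d ∷ ds) ℕ.+ gapBound gaps)
  W = Fquot (d ∷ ds)
  Y = Fprod (d ∷ ds) ⊛ gapSeries gaps
  negate-twice : ∀ c s w → - (c * (- s * w)) ≡ c * (s * w)
  negate-twice = solve-∀ ℚ-ring
  shifted-coefficient : (shift m W ⊕ shift (suc m) Y) n ≡ W (suc p) + Y p
  shifted-coefficient = cong₂ _+_ (trans (cong (shift m W) (sym (ℕP.+-suc m p))) (shift-+ m W (suc p))) (shift-+ m Y p)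

K≡p!*coefficients : ∀ {m} d (ds : Vec ℕ m) pos gaps → Unique gaps →
  ∀ N → (∀ k → N < k → QCoeff (d ∷ ds) gaps k ≡ + 0) → ∀ p →
  K (d ∷ ds) pos gaps N p ≡ ℕ→ℚ (p !) * (Fquot (d ∷ ds) (suc p) + (Fprod (d ∷ ds) ⊛ gapSeries gaps) p)
K≡p!*coefficients {m} d ds pos gaps unique N Q≡0 p = begin
  K (d ∷ ds) pos gaps N p
    ≡⟨ /≡*1/ℕ (sgn ℤ.* + (p !) ℤ.* 𝒞 (d ∷ ds) gaps N n) (π ℕ.* n !) ⟩
  ℤ→ℚ (sgn ℤ.* + (p !) ℤ.* 𝒞 (d ∷ ds) gaps N n) * 1/ℕ (π ℕ.* n !)
    ≡⟨ cong₂ _*_ (trans (ℤ→ℚ-homo-* (sgn ℤ.* + (p !)) _) (cong (_* ℤ→ℚ (𝒞 (d ∷ ds) gaps N n)) (ℤ→ℚ-homo-* sgn (+ (p !)))))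
                 (1/ℕ-homo-* π (n !)) ⟩
  sign (suc m) * ℕ→ℚ (p !) * ℤ→ℚ (𝒞 (d ∷ ds) gaps N n) * (1/ℕ π * 1/ℕ (n !))
    ≡⟨ cong (λ x → sign (suc m) * ℕ→ℚ (p !) * x * (1/ℕ π * 1/ℕ (n !))) 𝒞-value ⟩
  sign (suc m) * ℕ→ℚ (p !) * (ℕ→ℚ (n !) * (sign (suc m) * ℕ→ℚ π * Z)) * (1/ℕ π * 1/ℕ (n !))
    ≡⟨ regroup (sign (suc m)) (ℕ→ℚ (p !)) (ℕ→ℚ (n !)) (ℕ→ℚ π) Z (1/ℕ π) (1/ℕ (n !)) ⟩
  (sign (suc m) * sign (suc m)) * (ℕ→ℚ π * 1/ℕ π) * (ℕ→ℚ (n !) * 1/ℕ (n !)) * (ℕ→ℚ (p !) * Z)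
    ≡⟨ cong₂ (λ x y → x * y * (ℕ→ℚ (p !) * Z)) (cong₂ _*_ (sign*sign (suc m)) (n*[1/n]≡1 π)) (n*[1/n]≡1 (n !)) ⟩
  1ℚ * 1ℚ * 1ℚ * (ℕ→ℚ (p !) * Z)
    ≡⟨ ℚP.*-identityˡ (ℕ→ℚ (p !) * Z) ⟩
  ℕ→ℚ (p !) * Z
    ∎
  where
  open ≡-Reasoning
  n = suc (m ℕ.+ p)
  sgn = (ℤ.- + 1) ℤ.^ suc m
  π = πm (d ∷ ds)
  instance
    π≢0 : NonZero π
    π≢0 = πm-nonZero (d ∷ ds) pos
    n!≢0 : NonZero (n !)
    n!≢0 = n ℕP.!≢0
    π*n!≢0 : NonZero (π ℕ.* n !)
    π*n!≢0 = ℕP.m*n≢0 π (n !)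
  Z = Fquot (d ∷ ds) (suc p) + (Fprod (d ∷ ds) ⊛ gapSeries gaps) p
  𝒞-value : ℤ→ℚ (𝒞 (d ∷ ds) gaps N n) ≡ ℕ→ℚ (n !) * (sign (suc m) * ℕ→ℚ π * Z)
  𝒞-value = trans (𝒞≡n!*signedπ*coefficients d ds gaps unique N Q≡0 p)
                  (cong (λ x → ℕ→ℚ (n !) * (x * Z)) (signedπ≡sign*πm (d ∷ ds)))
  regroup : ∀ s a c q z r₁ r₂ → s * a * (c * (s * q * z)) * (r₁ * r₂) ≡ (s * s) * (q * r₁) * (c * r₂) * (a * z)
  regroup = solve-∀ ℚ-ring

C*r!*[p∸r]!≡p! : ∀ p r → r ≤ p → (p C r) ℕ.* (r ! ℕ.* (p ∸ r) !) ≡ p !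
C*r!*[p∸r]!≡p! p r r≤p = trans (cong (ℕ._* (r ! ℕ.* (p ∸ r) !)) (nCk≡n!/k![n-k]! r≤p)) (m/n*n≡m (k![n∸k]!∣n! r≤p))
  where instance _ = r ℕP.!* (p ∸ r) !≢0

binomial-sum : ∀ {m} (ds : Vec ℕ m) gaps p →
  Σℚ< (suc p) (λ r → ℕ→ℚ (p C r) * T (p ∸ r) (σ ds) * G gaps r) ≡ ℕ→ℚ (p !) * (Fprod ds ⊛ gapSeries gaps) p
binomial-sum ds gaps p = begin
  Σℚ< (suc p) term                                        ≡⟨ Σℚ<≡∑ (suc p) term ⟩
  ∑ (suc p) term                                          ≡⟨ ∑-cong-< (suc p) term≡ ⟩
  ∑ (suc p) (λ r → ℕ→ℚ (p !) * (E r * P (p ∸ r)))         ≡⟨ ∑-*ˡ (suc p) (ℕ→ℚ (p !)) (λ r → E r * P (p ∸ r)) ⟩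
  ℕ→ℚ (p !) * ∑ (suc p) (λ r → E r * P (p ∸ r))           ≡⟨ cong (ℕ→ℚ (p !) *_) (trans (sym (⊛-≡-∑ E P p)) (⊛-comm E P p)) ⟩
  ℕ→ℚ (p !) * (P ⊛ E) p                                   ∎
  where
  open ≡-Reasoning
  P = Fprod ds
  E = gapSeries gaps
  term : ℕ → ℚ
  term r = ℕ→ℚ (p C r) * T (p ∸ r) (σ ds) * G gaps r
  regroup : ∀ c a x b y → c * (a * x) * (b * y) ≡ (c * (b * a)) * (y * x)
  regroup = solve-∀ ℚ-ring
  term≡ : ∀ r → r < suc p → term r ≡ ℕ→ℚ (p !) * (E r * P (p ∸ r))
  term≡ r r<1+p = begin
    ℕ→ℚ (p C r) * T (p ∸ r) (σ ds) * G gaps r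
      ≡⟨ cong₂ (λ x y → ℕ→ℚ (p C r) * x * y) (T-σ ds (p ∸ r)) (G≡r!*gapSeries gaps r) ⟩
    ℕ→ℚ (p C r) * (ℕ→ℚ ((p ∸ r) !) * P (p ∸ r)) * (ℕ→ℚ (r !) * E r)
      ≡⟨ regroup (ℕ→ℚ (p C r)) (ℕ→ℚ ((p ∸ r) !)) (P (p ∸ r)) (ℕ→ℚ (r !)) (E r) ⟩
    ℕ→ℚ (p C r) * (ℕ→ℚ (r !) * ℕ→ℚ ((p ∸ r) !)) * (E r * P (p ∸ r))
      ≡⟨ cong (_* (E r * P (p ∸ r))) (trans (ℕ→ℚ-homo-* (p C r) (r ! ℕ.* (p ∸ r) !)) (cong (ℕ→ℚ (p C r) *_) (ℕ→ℚ-homo-* (r !) ((p ∸ r) !)))) ⟨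
    ℕ→ℚ ((p C r) ℕ.* (r ! ℕ.* (p ∸ r) !)) * (E r * P (p ∸ r))
      ≡⟨ cong (λ k → ℕ→ℚ k * (E r * P (p ∸ r))) (C*r!*[p∸r]!≡p! p r (ℕP.≤-pred r<1+p)) ⟩
    ℕ→ℚ (p !) * (E r * P (p ∸ r))
      ∎

δ-term : ∀ {m} (ds : Vec ℕ m) p → ℕ→ℚ (2 ^ suc p) * inv p * T (suc p) (δ ds) ≡ ℕ→ℚ (p !) * Fquot ds (suc p)
δ-term ds p = begin
  ℕ→ℚ (2 ^ suc p) * inv p * T (suc p) (δ ds)          ≡⟨ swap (ℕ→ℚ (2 ^ suc p)) (inv p) (T (suc p) (δ ds)) ⟩
  inv p * (ℕ→ℚ (2 ^ suc p) * T (suc p) (δ ds))        ≡⟨ cong (inv p *_) (T-δ ds (suc p)) ⟩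
  inv p * (ℕ→ℚ (suc p !) * Fquot ds (suc p))          ≡⟨ cong (λ x → inv p * (x * Fquot ds (suc p))) (ℕ→ℚ-homo-* (suc p) (p !)) ⟩
  inv p * (ℕ→ℚ (suc p) * ℕ→ℚ (p !) * Fquot ds (suc p)) ≡⟨ cancel (inv p) (ℕ→ℚ (suc p)) _ _ (trans (ℚP.*-comm (inv p) _) (n*[1/n]≡1 (suc p))) ⟩
  ℕ→ℚ (p !) * Fquot ds (suc p)                         ∎
  where
  open ≡-Reasoning
  swap : ∀ a b x → a * b * x ≡ b * (a * x)
  swap = solve-∀ ℚ-ring
  cancel : ∀ r c a x → r * c ≡ 1ℚ → r * (c * a * x) ≡ a * x
  cancel r c a x rc≡1 = trans (regroup r c a x) (trans (cong (_* (a * x)) rc≡1) (ℚP.*-identityˡ (a * x)))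
    where
    regroup : ∀ r c a x → r * (c * a * x) ≡ (r * c) * (a * x)
    regroup = solve-∀ ℚ-ring

theorem1p11 : (m : ℕ) → 1 ≤ m → (ds : Vec ℕ m) → (pos : All (0 <_) ds) →
    gcdVec ds ≡ 1 →
    (gaps : List ℕ) → Unique gaps →
    (∀ n → n ∈ gaps → ¬ InS ds n) → (∀ n → ¬ InS ds n → n ∈ gaps) →
    (N : ℕ) → (∀ k → N < k → QCoeff ds gaps k ≡ + 0) →
    (p : ℕ) →
    K ds pos gaps N p
      ≡ Σℚ< (suc p) (λ r → ℕ→ℚ (p C r) * T (p ∸ r) (σ ds) * G gaps r)
        + ℕ→ℚ (2 ^ suc p) * inv p * T (suc p) (δ ds)
-- Only finiteness and distinctness of the gaps matter: QCoeff is built from the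
-- list itself.
theorem1p11 zero    ()
theorem1p11 (suc m) _ (d ∷ ds) pos _ gaps unique _ _ N Q≡0 p = begin
  K (d ∷ ds) pos gaps N p                                        ≡⟨ K≡p!*coefficients d ds pos gaps unique N Q≡0 p ⟩
  ℕ→ℚ (p !) * (Fquot (d ∷ ds) (suc p) + (Fprod (d ∷ ds) ⊛ gapSeries gaps) p)
                                                                 ≡⟨ distrib-swap (ℕ→ℚ (p !)) _ _ ⟩
  ℕ→ℚ (p !) * (Fprod (d ∷ ds) ⊛ gapSeries gaps) p + ℕ→ℚ (p !) * Fquot (d ∷ ds) (suc p)
                                                                 ≡⟨ cong₂ _+_ (binomial-sum (d ∷ ds) gaps p) (δ-term (d ∷ ds) p) ⟨
  Σℚ< (suc p) (λ r → ℕ→ℚ (p C r) * T (p ∸ r) (σ (d ∷ ds)) * G gaps r)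
    + ℕ→ℚ (2 ^ suc p) * inv p * T (suc p) (δ (d ∷ ds))           ∎
  where
  open ≡-Reasoning
  distrib-swap : ∀ c w y → c * (w + y) ≡ c * y + c * w
  distrib-swap = solve-∀ ℚ-ring
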